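{- Let $G$ be a finite additive abelian group, $\Sigma=(\Gamma,\sigma)$ an unbalanced signed graph with underlying graph $\Gamma=(V,E)$, $\omega$ an orientation compatible with $\sigma$, and $f$ a $G$-tension of $\Sigma$. Let $\delta:G^V\to G^E$ be defined by $(\delta g)(e)=\omega(v,e)g(v)+\omega(u,e)g(u)$ for each edge $e$ with half-edges $(u,e),(v,e)$. Then $f$ lies in the image of $\delta$ if and only if $\sum_{e\in E(X)}f(e)\in 2G$ for every unbalanced cycle $X$ of $\Sigma$. Consequently, $f$ lies in the image of $\delta$ if and only if $f$ is a $G$-potential difference.
   Context: A signed graph $\Sigma=(\Gamma,\sigma)$: finite graph $\Gamma=(V,E)$ (loops, multiple edges allowed), $\sigma:E\to\{ -1,1\}$. A cycle (loops included) is balanced if the product of its edge signs is $1$, unbalanced otherwise; $\Sigma$ is unbalanced if it has an unbalanced cycle. $E(X)$ is the edge set of the cycle $X$. Each edge $e$ with endpoints $u,v$ has half-edges $(u,e),(v,e)$ (a loop at $v$ has two at $v$); an orientation $\omega$ assigns $\pm1$ to each half-edge, compatible with $\sigma$ if $\sigma(e)=-\omega(u,e)\omega(v,e)$. A walk $(v_1,e_1,\dots,v_k,e_k,v_{k+1})$ has $e_i$ joining $v_i,v_{i+1}$; $\omega(v_i,e_i)$ is the orientation of the half-edge of $e_i$ at $v_i$ by which the walk leaves $v_i$. Circuits of $\Sigma$: edge sets of balanced cycles, of unbalanced tight handcuffs (two unbalanced cycles sharing exactly one vertex) and of unbalanced loose handcuffs (two vertex-disjoint unbalanced cycles joined by a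 path meeting them only at its endpoints, whose edges are circuit path edges). A circuit walk is a closed walk traversing a circuit using circuit path edges twice and other edges once. $f:E\to G$ is a $G$-tension if for every circuit walk $(v_1,e_1,\dots,v_k,e_k,v_1)$, $\sum_{i=1}^k\big(\omega(v_i,e_i)\prod_{j<i}\sigma(e_j)\big)f(e_i)=0$; a $G$-potential difference if additionally $\sum_if(e_i)\in 2G=\{x+x:x\in G\}$ for every closed walk $(v_1,e_1,\dots,e_k,v_1)$ around an unbalanced cycle. -}

module Defs where

open import Level using (Level; _⊔_)
open import Data.Nat using (ℕ; zero; suc; _+_; _*_)
open import Data.Fin using (Fin; _≟_)
open import Data.Bool using (Bool; true; false; not)
open import Data.List using (List; []; _∷_; map; filter; length)
open import Data.List.Membership.Propositional using (_∈_; _∉_)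
open import Data.List.Relation.Unary.Unique.Propositional using (Unique)
open import Data.Product using (Σ; ∃; ∃-syntax; _×_; _,_; proj₁; proj₂)
open import Data.Sign.Base using (Sign; opposite) renaming (_*_ to _·_)
import Data.Sign.Base as Sgn
open import Relation.Binary.PropositionalEquality using (_≡_)
open import Relation.Nullary using (¬_)
open import Data.Empty using (⊥)
open import Data.Unit using (⊤)
open import Algebra.Bundles using (AbelianGroup)

-- Every edge e has two
-- half-edges, indexed by a Bool "side"; end e b is the vertex of the
-- half-edge (e , b).  A loop is an edge with end e false ≡ end e true.

record SignedGraph : Set where
  field
    nV   : ℕ
    nE   : ℕ
    end  : Fin nE → Bool → Fin nV
    sign : Fin nE → Sign

open SignedGraph public

module _ (S : SignedGraph) where

  HalfEdge : Set
  HalfEdge = Fin (nE S) × Bool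

  Step : Set
  Step = Fin (nE S) × Bool

  tailOf : Step → Fin (nV S)
  tailOf (e , b) = end S e b

  headOf : Step → Fin (nV S)
  headOf (e , b) = end S e (not b)

  IsWalk : Fin (nV S) → List Step → Fin (nV S) → Set
  IsWalk v []       w = v ≡ w
  IsWalk v (s ∷ ss) w = tailOf s ≡ v × IsWalk (headOf s) ss w

  edgesOf : List Step → List (Fin (nE S))
  edgesOf = map proj₁

  occ : Fin (nE S) → List Step → ℕ
  occ e ss = length (filter (e ≟_) (edgesOf ss))

  signProd : List Step → Sign
  signProd []            = Sign.+
  signProd ((e , _) ∷ ss) = sign S e · signProd ss

  NonEmpty : List Step → Set
  NonEmpty []      = ⊥
  NonEmpty (_ ∷ _) = ⊤

  record Cycle : Set where
    constructor mkCycle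
    field
      start    : Fin (nV S)
      steps    : List Step
      closed   : IsWalk start steps start
      nonempty : NonEmpty steps
      vdistinct : Unique (map tailOf steps)
      edistinct : Unique (edgesOf steps)

  open Cycle public

  cycVerts : Cycle → List (Fin (nV S))
  cycVerts X = map tailOf (steps X)

  cycEdges : Cycle → List (Fin (nE S))
  cycEdges X = edgesOf (steps X)

  Balanced : Cycle → Set
  Balanced X = signProd (steps X) ≡ Sign.+

  Unbalanced : Cycle → Set
  Unbalanced X = ¬ Balanced X

  UnbalancedGraph : Set
  UnbalancedGraph = Σ Cycle Unbalanced

  record Path (x y : Fin (nV S)) : Set where
    constructor mkPath
    field
      psteps : List Step
      pwalk  : IsWalk x psteps y
      pdistinct : Unique (x ∷ map headOf psteps)

  open Path public

  pathVerts : ∀ {x y} → Path x y → List (Fin (nV S))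
  pathVerts {x} P = x ∷ map headOf (psteps P)

  data Circuit : Set where
    balancedCycle : (X : Cycle) → Balanced X → Circuit
    tightHandcuff : (X Y : Cycle) → Unbalanced X → Unbalanced Y →
      (∀ e → e ∈ cycEdges X → e ∉ cycEdges Y) →
      (w : Fin (nV S)) → w ∈ cycVerts X → w ∈ cycVerts Y →
      (∀ u → u ∈ cycVerts X → u ∈ cycVerts Y → u ≡ w) →
      Circuit
    looseHandcuff : (X Y : Cycle) → Unbalanced X → Unbalanced Y →
      (∀ u → u ∈ cycVerts X → u ∉ cycVerts Y) →
      (x y : Fin (nV S)) → x ∈ cycVerts X → y ∈ cycVerts Y →
      (P : Path x y) →
      (∀ u → u ∈ pathVerts P → u ∈ cycVerts X → u ≡ x) →
      (∀ u → u ∈ pathVerts P → u ∈ cycVerts Y → u ≡ y) →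
      Circuit

  circMult : Circuit → Fin (nE S) → ℕ
  circMult (balancedCycle X _) e = occ e (steps X)
  circMult (tightHandcuff X Y _ _ _ _ _ _ _) e = occ e (steps X) + occ e (steps Y)
  circMult (looseHandcuff X Y _ _ _ _ _ _ _ P _ _) e =
    occ e (steps X) + occ e (steps Y) + 2 * occ e (psteps P)

  record CircuitWalk : Set where
    constructor mkCircuitWalk
    field
      cwStart  : Fin (nV S)
      cwSteps  : List Step
      cwClosed : IsWalk cwStart cwSteps cwStart
      circuit  : Circuit
      cwMult   : ∀ e → occ e cwSteps ≡ circMult circuit e

  open CircuitWalk public

  Orientation : Set
  Orientation = Fin (nE S) → Bool → Sign

  Compatible : Orientation → Set
  Compatible ω = ∀ e → sign S e ≡ opposite (ω e false · ω e true)

module _ {c ℓ : Level} (G : AbelianGroup c ℓ) where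
  open AbelianGroup G

  FiniteGroup : Set (c ⊔ ℓ)
  FiniteGroup = ∃[ k ] Σ (Fin k → Carrier) λ enum → ∀ x → ∃[ i ] enum i ≈ x

  act : Sign → Carrier → Carrier
  act Sign.+ x = x
  act Sign.- x = x ⁻¹

  In2G : Carrier → Set (c ⊔ ℓ)
  In2G x = ∃[ y ] (y ∙ y) ≈ x

  module _ (S : SignedGraph) (ω : Orientation S) (f : Fin (nE S) → Carrier) where

    tensionSumFrom : Sign → List (Step S) → Carrier
    tensionSumFrom s []            = ε
    tensionSumFrom s ((e , b) ∷ ss) =
      act (ω e b · s) (f e) ∙ tensionSumFrom (s · sign S e) ss

    tensionSum : List (Step S) → Carrier
    tensionSum = tensionSumFrom Sign.+

    plainSum : List (Step S) → Carrier
    plainSum []            = ε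
    plainSum ((e , _) ∷ ss) = f e ∙ plainSum ss

    IsTension : Set ℓ
    IsTension = ∀ (W : CircuitWalk S) → tensionSum (cwSteps W) ≈ ε

    IsPotentialDifference : Set (c ⊔ ℓ)
    IsPotentialDifference =
      IsTension × (∀ (X : Cycle S) → Unbalanced S X → In2G (plainSum (steps X)))

    -- Σ_{e ∈ E(X)} f(e) ∈ 2G for every unbalanced cycle X
    -- (edges of a cycle are distinct, so this is the sum over E(X))
    UnbalancedCycleCondition : Set (c ⊔ ℓ)
    UnbalancedCycleCondition =
      ∀ (X : Cycle S) → Unbalanced S X → In2G (plainSum (steps X))

  δ : (S : SignedGraph) → Orientation S → (Fin (nV S) → Carrier) → Fin (nE S) → Carrier
  δ S ω g e = act (ω e true) (g (end S e true)) ∙ act (ω e false) (g (end S e false))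

  InImageδ : (S : SignedGraph) → Orientation S → (Fin (nE S) → Carrier) → Set (c ⊔ ℓ)
  InImageδ S ω f = ∃[ g ] ∀ e → δ S ω g e ≈ f e

module Submission where

-- Along a closed walk the plain sum of δg is a sum of terms ±g(u) ± g(v) in which every vertex
-- value occurs twice, so it lies in 2G; this is the forward direction.
--
-- Conversely, work in one connected component at a time.  Along a breadth-first spanning forest,
-- g can be chosen so that δg = f on every tree edge.  A non-tree edge e closes, with the two tree
-- paths to their common ancestor, a fundamental cycle; if that cycle is balanced, the tension
-- condition forces δg(e) = f(e), e being its only edge on which δg and f may differ.  If some
-- fundamental cycle U is unbalanced, regrow the forest from all vertices of U, with values on U
-- solving g = c - g around U (solvable since c ≡ Σ_U f lies in 2G).  Then every non-tree edge lies,
-- exactly once, on a balanced circuit walk: a balanced fundamental cycle, a tight or loose handcuff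
-- with U, or one of the two cycles obtained by splitting U at the roots reached by its tree paths,
-- whose signs multiply to sign(U) = -1.

open import Defs
open import Level using (Level; _⊔_)
open import Data.Nat using (ℕ; zero; suc; pred; _+_; _*_; _≤_; _<_; z≤n; s≤s)
open import Data.Nat.Properties as ℕ using (≤-refl; ≤-trans; ≤-reflexive; <-irrefl)
open import Data.Fin using (Fin; _≟_)
import Data.Fin as Fin
import Data.Bool
import Data.Bool.Properties
import Data.Maybe.Properties
import Data.Product.Properties
open import Data.Fin.Properties using (any?; all?; ¬∀⟶∃¬)
open import Data.Maybe using (Maybe; just; nothing)
import Data.Maybe as Maybe
open import Data.Bool using (Bool; true; false; not)
open import Data.Bool.Properties using (not-involutive)
open import Data.List using (List; []; _∷_; _++_; map; filter; length; reverse; [_])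
open import Data.List.Properties using (map-++; filter-++; filter-none; length-++; unfold-reverse; ++-assoc; ++-identityʳ)
open import Data.List.Relation.Unary.All as All using (All; []; _∷_)
import Data.List.Relation.Unary.All.Properties as All
open import Data.List.Relation.Unary.Any using (here; there)
open import Data.List.Membership.Propositional using (_∈_; _∉_)
import Data.List.Membership.DecPropositional
open import Data.List.Membership.Propositional.Properties using (∈-++⁺ˡ; ∈-++⁺ʳ; ∈-++⁻; ∈-map⁻; ∈-map⁺; ∈-∃++)
open import Data.List.Relation.Unary.Unique.Propositional using (Unique)
import Data.List.Relation.Unary.Unique.Propositional.Properties as Unique
open import Data.List.Relation.Binary.Disjoint.Propositional using (Disjoint)
open import Data.List.Relation.Binary.Permutation.Propositional using (_↭_; ↭-reflexive; ↭-sym; ↭-trans)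
open import Data.List.Relation.Binary.Permutation.Propositional.Properties using (∈-resp-↭; All-resp-↭)
import Data.List.Relation.Binary.Permutation.Propositional as ↭
open import Data.List.Relation.Unary.AllPairs using ([]; _∷_)
open import Data.Product using (∃; ∃-syntax; _×_; _,_; proj₁; proj₂)
open import Data.Sum using (_⊎_; inj₁; inj₂)
import Data.Sum
open import Function using (_∘_; _$_)
open import Relation.Binary.Definitions using (DecidableEquality; tri<; tri≈; tri>)
open import Data.Sign.Base using (Sign; opposite) renaming (_*_ to _·_)
import Data.Sign.Base as Sign
import Data.Sign.Properties as Sign
open import Data.Empty using (⊥; ⊥-elim)
open import Relation.Nullary using (¬_; yes; no; Dec; does)
open import Relation.Nullary.Decidable using (_×-dec_; _⊎-dec_; ¬?; dec⇒maybe; dec-true)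
open import Relation.Binary.PropositionalEquality as ≡ using (_≡_; _≢_; cong; cong₂)
open import Algebra.Bundles using (AbelianGroup)
open import Function.Bundles using (_⇔_; mk⇔)
import Algebra.Properties.AbelianGroup as AbelianGroupProperties
import Algebra.Properties.CommutativeSemigroup as CommutativeSemigroupProperties
import Relation.Binary.Reasoning.Setoid as SetoidReasoning

module _ {a} {A : Set a} where
  open import Data.List.Relation.Binary.Permutation.Propositional using (↭⇒↭ₛ)
  import Data.List.Relation.Binary.Permutation.Setoid.Properties as SetoidPermutation

  Unique-++⁻ : ∀ (xs : List A) {ys} → Unique (xs ++ ys) → Unique xs × Unique ys × Disjoint xs ys
  Unique-++⁻ []       u       = [] , u , λ ()
  Unique-++⁻ (x ∷ xs) (x∉ ∷ u) with Unique-++⁻ xs u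
  ... | u₁ , u₂ , disjoint = All.tabulate (λ v∈ → All.lookup x∉ (∈-++⁺ˡ v∈)) ∷ u₁ , u₂ , disjoint′
    where
    disjoint′ : Disjoint (x ∷ xs) _
    disjoint′ (here ≡.refl , v∈ys) = All.lookup x∉ (∈-++⁺ʳ xs v∈ys) ≡.refl
    disjoint′ (there v∈xs  , v∈ys) = disjoint (v∈xs , v∈ys)

  Unique-resp-↭ : ∀ {xs ys : List A} → xs ↭ ys → Unique xs → Unique ys
  Unique-resp-↭ p = SetoidPermutation.Unique-resp-↭ (≡.setoid A) (↭⇒↭ₛ p)

module _ where
  open ≡ using (refl; sym; trans)

  leastTrue≤ : (ℕ → Bool) → ℕ → ℕ
  leastTrue≤ p zero    = zero
  leastTrue≤ p (suc m) = Data.Bool.if p 0 then 0 else suc (leastTrue≤ (λ k → p (suc k)) m)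

  leastTrue≤-true : ∀ (p : ℕ → Bool) m → p m ≡ true → p (leastTrue≤ p m) ≡ true
  leastTrue≤-true p zero    pm = pm
  leastTrue≤-true p (suc m) pm with p 0 in p0
  ... | true  = p0
  ... | false = leastTrue≤-true (λ k → p (suc k)) m pm

  leastTrue≤-minimal : ∀ (p : ℕ → Bool) m j → j < leastTrue≤ p m → p j ≡ false
  leastTrue≤-minimal p (suc m) j j< with p 0 in p0
  leastTrue≤-minimal p (suc m) j       ()        | true
  leastTrue≤-minimal p (suc m) zero    _         | false = p0
  leastTrue≤-minimal p (suc m) (suc j) (s≤s j<)  | false = leastTrue≤-minimal (λ k → p (suc k)) m j j<

  leastTrue≤-≤ : ∀ (p : ℕ → Bool) m → leastTrue≤ p m ≤ m
  leastTrue≤-≤ p zero    = z≤n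
  leastTrue≤-≤ p (suc m) with p 0
  ... | true  = z≤n
  ... | false = s≤s (leastTrue≤-≤ (λ k → p (suc k)) m)

  firstTrue : ∀ {m} → (Fin m → Bool) → Maybe (Fin m)
  firstTrue {zero}  p = nothing
  firstTrue {suc m} p = Data.Bool.if p Fin.zero then just Fin.zero else Maybe.map Fin.suc (firstTrue (λ i → p (Fin.suc i)))

  firstTrue-true : ∀ {m} (p : Fin m → Bool) v → p v ≡ true → ∃[ r ] firstTrue p ≡ just r × p r ≡ true
  firstTrue-true {suc m} p Fin.zero    pv rewrite pv = Fin.zero , refl , pv
  firstTrue-true {suc m} p (Fin.suc v) pv with p Fin.zero in p0
  ... | true  = Fin.zero , refl , p0
  ... | false with firstTrue-true (λ i → p (Fin.suc i)) v pv
  ...   | r , first≡r , pr = Fin.suc r , cong (Maybe.map Fin.suc) first≡r , pr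

  firstTrue-cong : ∀ {m} {p q : Fin m → Bool} → (∀ i → p i ≡ q i) → firstTrue p ≡ firstTrue q
  firstTrue-cong {zero}  p≗q = refl
  firstTrue-cong {suc m} p≗q rewrite p≗q Fin.zero | firstTrue-cong {m} (λ i → p≗q (Fin.suc i)) = refl

module SignAction {c ℓ} (G : AbelianGroup c ℓ) where
  open AbelianGroup G
  open AbelianGroupProperties G using (ε⁻¹≈ε; ⁻¹-involutive; ⁻¹-∙-comm)
  open CommutativeSemigroupProperties commutativeSemigroup using (interchange)
  open SetoidReasoning setoid

  act-cong : ∀ s {x y} → x ≈ y → act G s x ≈ act G s y
  act-cong Sign.+ p = p
  act-cong Sign.- p = ⁻¹-cong p

  act-∙ : ∀ s x y → act G s (x ∙ y) ≈ act G s x ∙ act G s y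
  act-∙ Sign.+ x y = refl
  act-∙ Sign.- x y = sym (⁻¹-∙-comm x y)

  act-ε : ∀ s → act G s ε ≈ ε
  act-ε Sign.+ = refl
  act-ε Sign.- = ε⁻¹≈ε

  act-· : ∀ s t x → act G (s · t) x ≈ act G s (act G t x)
  act-· Sign.+ t x = refl
  act-· Sign.- Sign.+ x = refl
  act-· Sign.- Sign.- x = sym (⁻¹-involutive x)

  act-opposite : ∀ s x → act G (opposite s) x ≈ act G s x ⁻¹
  act-opposite Sign.+ x = refl
  act-opposite Sign.- x = sym (⁻¹-involutive x)

  act-involutive : ∀ s x → act G s (act G s x) ≈ x
  act-involutive s x = trans (sym (act-· s s x)) (reflexive (cong (λ t → act G t x) (Sign.s*s≡+ s)))

  act≈ε⇒≈ε : ∀ s {x} → act G s x ≈ ε → x ≈ ε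
  act≈ε⇒≈ε s {x} p = trans (sym (act-involutive s x)) (trans (act-cong s p) (act-ε s))

  infix 4 _≈₂_

  _≈₂_ : Carrier → Carrier → Set (c ⊔ ℓ)
  x ≈₂ y = ∃[ w ] x ∙ (w ∙ w) ≈ y

  ≈⇒≈₂ : ∀ {x y} → x ≈ y → x ≈₂ y
  ≈⇒≈₂ {x} p = ε , trans (∙-congˡ (identityˡ ε)) (trans (identityʳ x) p)

  ≈₂-trans : ∀ {x y z} → x ≈₂ y → y ≈₂ z → x ≈₂ z
  ≈₂-trans {x} (w , p) (w′ , q) = w ∙ w′ , (begin
    x ∙ ((w ∙ w′) ∙ (w ∙ w′)) ≈⟨ ∙-congˡ (interchange w w′ w w′) ⟩
    x ∙ ((w ∙ w) ∙ (w′ ∙ w′)) ≈⟨ assoc x _ _ ⟨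
    (x ∙ (w ∙ w)) ∙ (w′ ∙ w′) ≈⟨ ∙-congʳ p ⟩
    _ ∙ (w′ ∙ w′)             ≈⟨ q ⟩
    _                         ∎)

  ≈₂-sym : ∀ {x y} → x ≈₂ y → y ≈₂ x
  ≈₂-sym {x} {y} (w , p) = w ⁻¹ , (begin
    y ∙ (w ⁻¹ ∙ w ⁻¹)                 ≈⟨ ∙-congʳ p ⟨
    (x ∙ (w ∙ w)) ∙ (w ⁻¹ ∙ w ⁻¹)     ≈⟨ assoc x _ _ ⟩
    x ∙ ((w ∙ w) ∙ (w ⁻¹ ∙ w ⁻¹))     ≈⟨ ∙-congˡ (interchange w w _ _) ⟩
    x ∙ ((w ∙ w ⁻¹) ∙ (w ∙ w ⁻¹))     ≈⟨ ∙-congˡ (∙-cong (inverseʳ w) (inverseʳ w)) ⟩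
    x ∙ (ε ∙ ε)                       ≈⟨ ∙-congˡ (identityʳ ε) ⟩
    x ∙ ε                             ≈⟨ identityʳ x ⟩
    x                                 ∎)

  ∙-cong₂ : ∀ {x y x′ y′} → x ≈₂ y → x′ ≈₂ y′ → x ∙ x′ ≈₂ y ∙ y′
  ∙-cong₂ {x} {y} {x′} {y′} (w , p) (w′ , q) = w ∙ w′ , (begin
    (x ∙ x′) ∙ ((w ∙ w′) ∙ (w ∙ w′)) ≈⟨ ∙-congˡ (interchange w w′ w w′) ⟩
    (x ∙ x′) ∙ ((w ∙ w) ∙ (w′ ∙ w′)) ≈⟨ interchange x x′ _ _ ⟩
    (x ∙ (w ∙ w)) ∙ (x′ ∙ (w′ ∙ w′)) ≈⟨ ∙-cong p q ⟩
    y ∙ y′                           ∎)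

  act≈₂ : ∀ s x → act G s x ≈₂ x
  act≈₂ Sign.+ x = ≈⇒≈₂ refl
  act≈₂ Sign.- x = x , (begin
    x ⁻¹ ∙ (x ∙ x) ≈⟨ assoc _ _ _ ⟨
    (x ⁻¹ ∙ x) ∙ x ≈⟨ ∙-congʳ (inverseˡ x) ⟩
    ε ∙ x          ≈⟨ identityˡ x ⟩
    x              ∎)

  double≈₂ε : ∀ x → x ∙ x ≈₂ ε
  double≈₂ε x = ≈₂-sym (x , identityˡ (x ∙ x))

  In2G⇒≈₂ε : ∀ {x} → In2G G x → x ≈₂ ε
  In2G⇒≈₂ε (w , w∙w≈x) = ≈₂-trans (≈⇒≈₂ (sym w∙w≈x)) (double≈₂ε w)

  ≈₂ε⇒In2G : ∀ {x} → x ≈₂ ε → In2G G x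
  ≈₂ε⇒In2G p with ≈₂-sym p
  ... | w , q = w , trans (sym (identityˡ _)) q

module Walks (S : SignedGraph) where
  open ≡ using (refl; sym; trans)
  open ≡.≡-Reasoning
  open import Data.List.Relation.Binary.Permutation.Propositional.Properties using (↭-length; filter-↭; ↭-reverse)
  import Data.List.Relation.Binary.Permutation.Propositional.Properties as ↭ₚ

  V : Set
  V = Fin (nV S)

  tails heads : List (Step S) → List V
  tails = map (tailOf S)
  heads = map (headOf S)

  reverseStep : Step S → Step S
  reverseStep (e , b) = e , not b

  reverseWalk : List (Step S) → List (Step S)
  reverseWalk []       = []
  reverseWalk (s ∷ ss) = reverseWalk ss ++ [ reverseStep s ]

  IsWalk-++ : ∀ {u v w} ss {ts} → IsWalk S u ss v → IsWalk S v ts w → IsWalk S u (ss ++ ts) w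
  IsWalk-++ []       refl        q = q
  IsWalk-++ (s ∷ ss) (t , p) q = t , IsWalk-++ ss p q

  IsWalk-++⁻ : ∀ {u w} ss {ts} → IsWalk S u (ss ++ ts) w → ∃[ v ] IsWalk S u ss v × IsWalk S v ts w
  IsWalk-++⁻ {u} []  q = u , refl , q
  IsWalk-++⁻ (s ∷ ss) (t , p) with IsWalk-++⁻ ss p
  ... | v , p₁ , p₂ = v , (t , p₁) , p₂

  IsWalk-reverse : ∀ {u w} ss → IsWalk S u ss w → IsWalk S w (reverseWalk ss) u
  IsWalk-reverse []             refl    = refl
  IsWalk-reverse ((e , b) ∷ ss) (t , p) =
    IsWalk-++ (reverseWalk ss) (IsWalk-reverse ss p) (refl , trans (cong (end S e) (not-involutive b)) t)

  All-reverseWalk : ∀ {p} {P : Fin (nE S) → Set p} ss → All (P ∘ proj₁) ss → All (P ∘ proj₁) (reverseWalk ss)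
  All-reverseWalk []       []       = []
  All-reverseWalk (s ∷ ss) (p ∷ ps) = All.++⁺ (All-reverseWalk ss ps) (p ∷ [])

  IsWalk-nonEmpty⇒∈tails : ∀ {u w} ss → IsWalk S u ss w → NonEmpty S ss → u ∈ tails ss
  IsWalk-nonEmpty⇒∈tails (s ∷ ss) (t , _) _ = here (sym t)

  tails-∷ʳ : ∀ {u w} ss → IsWalk S u ss w → tails ss ++ [ w ] ≡ u ∷ heads ss
  tails-∷ʳ []       refl    = refl
  tails-∷ʳ (s ∷ ss) (t , p) = cong₂ _∷_ t (tails-∷ʳ ss p)

  tails-reverseWalk : ∀ ss → tails (reverseWalk ss) ≡ reverse (heads ss)
  tails-reverseWalk []             = refl
  tails-reverseWalk ((e , b) ∷ ss) = begin
    tails (reverseWalk ss ++ [ e , not b ])          ≡⟨ map-++ (tailOf S) (reverseWalk ss) _ ⟩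
    tails (reverseWalk ss) ++ [ end S e (not b) ]    ≡⟨ cong (_++ _) (tails-reverseWalk ss) ⟩
    reverse (heads ss) ++ [ end S e (not b) ]        ≡⟨ unfold-reverse _ (heads ss) ⟨
    reverse (end S e (not b) ∷ heads ss)             ∎

  edgesOf-reverseWalk : ∀ ss → edgesOf S (reverseWalk ss) ≡ reverse (edgesOf S ss)
  edgesOf-reverseWalk []             = refl
  edgesOf-reverseWalk ((e , b) ∷ ss) = begin
    edgesOf S (reverseWalk ss ++ [ e , not b ])  ≡⟨ map-++ proj₁ (reverseWalk ss) _ ⟩
    edgesOf S (reverseWalk ss) ++ [ e ]          ≡⟨ cong (_++ [ e ]) (edgesOf-reverseWalk ss) ⟩
    reverse (edgesOf S ss) ++ [ e ]              ≡⟨ unfold-reverse e (edgesOf S ss) ⟨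
    reverse (e ∷ edgesOf S ss)                   ∎

  occ-++ : ∀ e ss ts → occ S e (ss ++ ts) ≡ occ S e ss + occ S e ts
  occ-++ e ss ts = begin
    length (filter (e ≟_) (edgesOf S (ss ++ ts)))
      ≡⟨ cong (λ es → length (filter (e ≟_) es)) (map-++ proj₁ ss ts) ⟩
    length (filter (e ≟_) (edgesOf S ss ++ edgesOf S ts))
      ≡⟨ cong length (filter-++ (e ≟_) (edgesOf S ss) _) ⟩
    length (filter (e ≟_) (edgesOf S ss) ++ filter (e ≟_) (edgesOf S ts))
      ≡⟨ length-++ (filter (e ≟_) (edgesOf S ss)) ⟩
    occ S e ss + occ S e ts ∎

  occ-reverseWalk : ∀ e ss → occ S e (reverseWalk ss) ≡ occ S e ss
  occ-reverseWalk e ss = trans (cong (λ es → length (filter (e ≟_) es)) (edgesOf-reverseWalk ss))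
    (↭-length (filter-↭ (e ≟_) (↭-reverse (edgesOf S ss))))

  occ-∉ : ∀ {e} ss → e ∉ edgesOf S ss → occ S e ss ≡ 0
  occ-∉ ss e∉ = cong length (filter-none (_ ≟_) (All.tabulate λ e∈ e≡ → e∉ (≡.subst (_∈ _) (sym e≡) e∈)))

  occ-[_] : ∀ e {b} → occ S e [ e , b ] ≡ 1
  occ-[ e ] with e ≟ e
  ... | yes _  = refl
  ... | no e≢e = ⊥-elim (e≢e refl)

  occ-↭ : ∀ e {ss ts} → ss ↭ ts → occ S e ss ≡ occ S e ts
  occ-↭ e p = ↭-length (filter-↭ (e ≟_) (↭ₚ.map⁺ proj₁ p))

  signProd-++ : ∀ ss ts → signProd S (ss ++ ts) ≡ signProd S ss · signProd S ts
  signProd-++ []             ts = refl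
  signProd-++ ((e , _) ∷ ss) ts =
    trans (cong (sign S e ·_) (signProd-++ ss ts)) (sym (Sign.*-assoc (sign S e) _ _))

  signProd-reverseWalk : ∀ ss → signProd S (reverseWalk ss) ≡ signProd S ss
  signProd-reverseWalk []             = refl
  signProd-reverseWalk ((e , b) ∷ ss) = begin
    signProd S (reverseWalk ss ++ [ e , not b ])       ≡⟨ signProd-++ (reverseWalk ss) _ ⟩
    signProd S (reverseWalk ss) · (sign S e · Sign.+)  ≡⟨ cong₂ _·_ (signProd-reverseWalk ss) (Sign.*-identityʳ _) ⟩
    signProd S ss · sign S e                           ≡⟨ Sign.*-comm (signProd S ss) _ ⟩
    sign S e · signProd S ss                           ∎

  signProd-↭ : ∀ {ss ts} → ss ↭ ts → signProd S ss ≡ signProd S ts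
  signProd-↭ ↭.refl                          = refl
  signProd-↭ (↭.prep (e , _) p)              = cong (sign S e ·_) (signProd-↭ p)
  signProd-↭ (↭.swap {xs} (e , _) (e′ , _) p) =
    trans (x∙yz≈y∙xz (sign S e) (sign S e′) (signProd S xs)) (cong (λ π → sign S e′ · (sign S e · π)) (signProd-↭ p))
    where open CommutativeSemigroupProperties Sign.*-commutativeSemigroup using (x∙yz≈y∙xz)
  signProd-↭ (↭.trans p q)                  = trans (signProd-↭ p) (signProd-↭ q)

  signProd-handcuff : ∀ C P X → signProd S (C ++ P ++ X ++ reverseWalk P) ≡ signProd S C · signProd S X
  signProd-handcuff C P X = begin
    signProd S (C ++ P ++ X ++ reverseWalk P)
      ≡⟨ signProd-++ C _ ⟩
    signProd S C · signProd S (P ++ X ++ reverseWalk P)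
      ≡⟨ cong (signProd S C ·_) (trans (signProd-++ P _) (cong (signProd S P ·_) (signProd-++ X _))) ⟩
    signProd S C · (signProd S P · (signProd S X · signProd S (reverseWalk P)))
      ≡⟨ cong (λ π → signProd S C · (signProd S P · (signProd S X · π))) (signProd-reverseWalk P) ⟩
    signProd S C · (signProd S P · (signProd S X · signProd S P))
      ≡⟨ cong (signProd S C ·_) (x∙yz≈y∙xz (signProd S P) (signProd S X) _) ⟩
    signProd S C · (signProd S X · (signProd S P · signProd S P))
      ≡⟨ cong (λ π → signProd S C · (signProd S X · π)) (Sign.s*s≡+ (signProd S P)) ⟩
    signProd S C · (signProd S X · Sign.+)
      ≡⟨ cong (signProd S C ·_) (Sign.*-identityʳ (signProd S X)) ⟩
    signProd S C · signProd S X ∎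
    where open CommutativeSemigroupProperties Sign.*-commutativeSemigroup using (x∙yz≈y∙xz)

  occ-handcuff : ∀ e C P X → occ S e (C ++ P ++ X ++ reverseWalk P) ≡ occ S e C + occ S e X + 2 * occ S e P
  occ-handcuff e C P X = begin
    occ S e (C ++ P ++ X ++ reverseWalk P)
      ≡⟨ occ-++ e C _ ⟩
    occ S e C + occ S e (P ++ X ++ reverseWalk P)
      ≡⟨ cong (occ S e C +_) (trans (occ-++ e P _) (cong (occ S e P +_) (occ-++ e X _))) ⟩
    occ S e C + (occ S e P + (occ S e X + occ S e (reverseWalk P)))
      ≡⟨ cong (λ n → occ S e C + (occ S e P + (occ S e X + n))) (occ-reverseWalk e P) ⟩
    occ S e C + (occ S e P + (occ S e X + occ S e P))
      ≡⟨ cong (occ S e C +_) (x∙yz≈y∙xz (occ S e P) (occ S e X) _) ⟩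
    occ S e C + (occ S e X + (occ S e P + occ S e P))
      ≡⟨ ℕ.+-assoc (occ S e C) _ _ ⟨
    occ S e C + occ S e X + (occ S e P + occ S e P)
      ≡⟨ cong (λ n → occ S e C + occ S e X + (occ S e P + n)) (ℕ.+-identityʳ (occ S e P)) ⟨
    occ S e C + occ S e X + 2 * occ S e P ∎
    where open CommutativeSemigroupProperties ℕ.+-commutativeSemigroup using (x∙yz≈y∙xz)

module ClosedWalks (S : SignedGraph) where
  open ≡ using (refl; sym; trans)
  open ≡.≡-Reasoning
  open Walks S
  import Data.List.Relation.Binary.Permutation.Propositional.Properties as ↭ₚ

  ∈tails⇒split : ∀ {v} ss → v ∈ tails ss → ∃[ pre ] ∃[ s ] ∃[ post ] ss ≡ pre ++ s ∷ post × tailOf S s ≡ v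
  ∈tails⇒split ss v∈ with ∈-map⁻ (tailOf S) v∈
  ... | s , s∈ , v≡t with ∈-∃++ s∈
  ...   | pre , post , ss≡ = pre , s , post , ss≡ , sym v≡t

  record Rotation (ss : List (Step S)) (v : V) : Set where
    field
      rotated : List (Step S)
      ↭ss     : rotated ↭ ss
      walk    : IsWalk S v rotated v

  rotate : ∀ {u v} ss → IsWalk S u ss u → v ∈ tails ss → Rotation ss v
  rotate ss closed v∈ with ∈tails⇒split ss v∈
  ... | pre , s , post , refl , t≡v with IsWalk-++⁻ pre closed
  ...   | m , toM , (t≡m , fromM) = record
    { rotated = (s ∷ post) ++ pre
    ; ↭ss     = ↭ₚ.++-comm (s ∷ post) pre
    ; walk    = ≡.subst (λ w → IsWalk S w ((s ∷ post) ++ pre) w) (trans (sym t≡m) t≡v)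
                  (IsWalk-++ (s ∷ post) (t≡m , fromM) toM)
    }

  closeUp : (L A R : List (Step S)) → Step S → List (Step S)
  closeUp L A R t = L ++ A ++ reverseWalk R ++ [ t ]

  closeUp-walk : ∀ {x y p q} L A R t → IsWalk S x L p → IsWalk S p A q → IsWalk S y R q →
                 tailOf S t ≡ y → headOf S t ≡ x → IsWalk S x (closeUp L A R t) x
  closeUp-walk L A R t wL wA wR t≡y h≡x =
    IsWalk-++ L wL (IsWalk-++ A wA (IsWalk-++ (reverseWalk R) (IsWalk-reverse R wR) (t≡y , h≡x)))

  tails-closeUp : ∀ {y q} L A R t → IsWalk S y R q → tailOf S t ≡ y →
                  tails (closeUp L A R t) ↭ tails L ++ tails A ++ q ∷ tails R
  tails-closeUp {y} {q} L A R t wR t≡y =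
    ↭-trans (↭-reflexive unfolded) (↭ₚ.++⁺ˡ (tails L) (↭ₚ.++⁺ˡ (tails A) (↭-trans (↭ₚ.↭-reverse _) (↭-sym (↭ₚ.∷↭∷ʳ q (tails R))))))
    where
    unfolded : tails (closeUp L A R t) ≡ tails L ++ tails A ++ reverse (tails R ++ [ q ])
    unfolded = begin
      tails (L ++ A ++ reverseWalk R ++ [ t ])
        ≡⟨ map-++ (tailOf S) L _ ⟩
      tails L ++ tails (A ++ reverseWalk R ++ [ t ])
        ≡⟨ cong (tails L ++_) (map-++ (tailOf S) A _) ⟩
      tails L ++ tails A ++ tails (reverseWalk R ++ [ t ])
        ≡⟨ cong (λ vs → tails L ++ tails A ++ vs) (map-++ (tailOf S) (reverseWalk R) _) ⟩
      tails L ++ tails A ++ tails (reverseWalk R) ++ [ tailOf S t ]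
        ≡⟨ cong₂ (λ vs v → tails L ++ tails A ++ vs ++ [ v ]) (tails-reverseWalk R) t≡y ⟩
      tails L ++ tails A ++ reverse (heads R) ++ [ y ]
        ≡⟨ cong (λ vs → tails L ++ tails A ++ vs) (unfold-reverse y (heads R)) ⟨
      tails L ++ tails A ++ reverse (y ∷ heads R)
        ≡⟨ cong (λ vs → tails L ++ tails A ++ reverse vs) (tails-∷ʳ R wR) ⟨
      tails L ++ tails A ++ reverse (tails R ++ [ q ]) ∎

  edgesOf-closeUp : ∀ L A R t → edgesOf S (closeUp L A R t) ↭ edgesOf S L ++ edgesOf S A ++ proj₁ t ∷ edgesOf S R
  edgesOf-closeUp L A R t = ↭-trans (↭-reflexive unfolded) (↭ₚ.++⁺ˡ (edgesOf S L) (↭ₚ.++⁺ˡ (edgesOf S A)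
    (↭-trans (↭ₚ.++-comm (reverse (edgesOf S R)) [ proj₁ t ]) (↭.prep (proj₁ t) (↭ₚ.↭-reverse (edgesOf S R))))))
    where
    unfolded : edgesOf S (closeUp L A R t) ≡ edgesOf S L ++ edgesOf S A ++ reverse (edgesOf S R) ++ [ proj₁ t ]
    unfolded = begin
      edgesOf S (L ++ A ++ reverseWalk R ++ [ t ])
        ≡⟨ map-++ proj₁ L _ ⟩
      edgesOf S L ++ edgesOf S (A ++ reverseWalk R ++ [ t ])
        ≡⟨ cong (edgesOf S L ++_) (map-++ proj₁ A _) ⟩
      edgesOf S L ++ edgesOf S A ++ edgesOf S (reverseWalk R ++ [ t ])
        ≡⟨ cong (λ es → edgesOf S L ++ edgesOf S A ++ es) (map-++ proj₁ (reverseWalk R) _) ⟩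
      edgesOf S L ++ edgesOf S A ++ edgesOf S (reverseWalk R) ++ [ proj₁ t ]
        ≡⟨ cong (λ es → edgesOf S L ++ edgesOf S A ++ es ++ [ proj₁ t ]) (edgesOf-reverseWalk R) ⟩
      edgesOf S L ++ edgesOf S A ++ reverse (edgesOf S R) ++ [ proj₁ t ] ∎

  closeUp-cycle : ∀ {x y p q} L A R t → IsWalk S x L p → IsWalk S p A q → IsWalk S y R q →
                  tailOf S t ≡ y → headOf S t ≡ x →
                  Unique (tails L ++ tails A ++ q ∷ tails R) →
                  Unique (edgesOf S L ++ edgesOf S A ++ proj₁ t ∷ edgesOf S R) → Cycle S
  closeUp-cycle {x} L A R t wL wA wR t≡y h≡x uniqueV uniqueE = mkCycle x (closeUp L A R t)
    (closeUp-walk L A R t wL wA wR t≡y h≡x) (NonEmpty-++ L (NonEmpty-++ A (NonEmpty-++ (reverseWalk R) _)))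
    (Unique-resp-↭ (↭-sym (tails-closeUp L A R t wR t≡y)) uniqueV)
    (Unique-resp-↭ (↭-sym (edgesOf-closeUp L A R t)) uniqueE)
    where
    NonEmpty-++ : ∀ ss {ts} → NonEmpty S ts → NonEmpty S (ss ++ ts)
    NonEmpty-++ []      ne = ne
    NonEmpty-++ (_ ∷ _) _  = _

  signProd-closeUp : ∀ L A R e b → signProd S (closeUp L A R (e , b)) ≡ signProd S L · (signProd S A · (signProd S R · sign S e))
  signProd-closeUp L A R e b = begin
    signProd S (L ++ A ++ reverseWalk R ++ [ e , b ])
      ≡⟨ signProd-++ L _ ⟩
    signProd S L · signProd S (A ++ reverseWalk R ++ [ e , b ])
      ≡⟨ cong (signProd S L ·_) (signProd-++ A _) ⟩
    signProd S L · (signProd S A · signProd S (reverseWalk R ++ [ e , b ]))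
      ≡⟨ cong (λ π → signProd S L · (signProd S A · π)) (signProd-++ (reverseWalk R) _) ⟩
    signProd S L · (signProd S A · (signProd S (reverseWalk R) · (sign S e · Sign.+)))
      ≡⟨ cong₂ (λ π σ → signProd S L · (signProd S A · (π · σ))) (signProd-reverseWalk R) (Sign.*-identityʳ (sign S e)) ⟩
    signProd S L · (signProd S A · (signProd S R · sign S e)) ∎

  signProd-closeUp-pair : ∀ L A R B e → signProd S (closeUp L A R (e , true)) · signProd S (closeUp R B L (e , false)) ≡
                                        signProd S A · signProd S B
  signProd-closeUp-pair L A R B e = begin
    signProd S (closeUp L A R (e , true)) · signProd S (closeUp R B L (e , false))
      ≡⟨ cong₂ _·_ (signProd-closeUp L A R e true) (signProd-closeUp R B L e false) ⟩
    (πL · (πA · (πR · σ))) · (πR · (πB · (πL · σ)))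
      ≡⟨ cong₂ _·_ (x∙yz≈y∙xz πL πA _) (trans (x∙yz≈y∙xz πR πB _) (cong (πB ·_) (x∙yz≈y∙xz πR πL σ))) ⟩
    (πA · κ) · (πB · κ)
      ≡⟨ interchange πA κ πB κ ⟩
    (πA · πB) · (κ · κ)
      ≡⟨ trans (cong ((πA · πB) ·_) (Sign.s*s≡+ κ)) (Sign.*-identityʳ _) ⟩
    πA · πB ∎
    where
    open CommutativeSemigroupProperties Sign.*-commutativeSemigroup using (x∙yz≈y∙xz; interchange)
    πL πR πA πB σ κ : Sign
    πL = signProd S L
    πR = signProd S R
    πA = signProd S A
    πB = signProd S B
    σ  = sign S e
    κ  = πL · (πR · σ)

  unbalanced⇒- : ∀ X → Unbalanced S X → signProd S (steps X) ≡ Sign.-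
  unbalanced⇒- X unbalanced with signProd S (steps X)
  ... | Sign.- = refl
  ... | Sign.+ = ⊥-elim (unbalanced refl)

  closedWalk-heads⊆tails : ∀ {u} ss → IsWalk S u ss u → NonEmpty S ss → ∀ {v} → v ∈ heads ss → v ∈ tails ss
  closedWalk-heads⊆tails ss closed nonEmpty v∈ with ∈-++⁻ (tails ss) (≡.subst (_ ∈_) (sym (tails-∷ʳ ss closed)) (there v∈))
  ... | inj₁ v∈tails   = v∈tails
  ... | inj₂ (here refl) = IsWalk-nonEmpty⇒∈tails ss closed nonEmpty

  closedWalk-ends : ∀ {u} ss → IsWalk S u ss u → NonEmpty S ss → ∀ {s} → s ∈ ss → ∀ b → end S (proj₁ s) b ∈ tails ss
  closedWalk-ends ss closed nonEmpty {e , b′} s∈ b with b Data.Bool.Properties.≟ b′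
  ... | yes refl = ∈-map⁺ (tailOf S) s∈
  ... | no b≢b′  = ≡.subst (λ b″ → end S e b″ ∈ tails ss) (sym (Data.Bool.Properties.¬-not b≢b′))
                     (closedWalk-heads⊆tails ss closed nonEmpty (∈-map⁺ (headOf S) s∈))

  record Arcs (X : Cycle S) (p q : V) : Set where
    field
      A B    : List (Step S)
      A-walk : IsWalk S p A q
      B-walk : IsWalk S q B p
      ↭X     : A ++ B ↭ steps X
      p∈A    : p ∈ tails A
      q∈B    : q ∈ tails B

  arcs : ∀ (X : Cycle S) {p q} → p ∈ cycVerts S X → q ∈ cycVerts S X → p ≢ q → Arcs X p q
  arcs X {p} {q} p∈ q∈ p≢q with rotate (steps X) (closed X) p∈
  ... | record { rotated = rotated ; ↭ss = ↭ss ; walk = walk }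
    with ∈tails⇒split rotated (∈-resp-↭ (↭ₚ.map⁺ (tailOf S) (↭-sym ↭ss)) q∈)
  ...   | A , s , B , refl , t≡q with IsWalk-++⁻ A walk
  ...     | m , A-walk , (t≡m , B-walk) = record
    { A = A ; B = s ∷ B ; A-walk = ≡.subst (IsWalk S p A) m≡q A-walk ; B-walk = ≡.subst (λ v → IsWalk S v (s ∷ B) p) m≡q (t≡m , B-walk)
    ; ↭X = ↭ss ; p∈A = p∈A A (≡.subst (IsWalk S p A) m≡q A-walk) ; q∈B = here (sym t≡q) }
    where
    m≡q : m ≡ q
    m≡q = trans (sym t≡m) t≡q
    p∈A : ∀ ss → IsWalk S p ss q → p ∈ tails ss
    p∈A []      p≡q′       = ⊥-elim (p≢q p≡q′)
    p∈A (_ ∷ _) (t≡p , _) = here (sym t≡p)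

  module ArcsProperties {X : Cycle S} {p q : V} (α : Arcs X p q) where
    open Arcs α

    uniqueTails : Unique (tails A ++ tails B)
    uniqueTails = ≡.subst Unique (map-++ (tailOf S) A B) (Unique-resp-↭ (↭-sym (↭ₚ.map⁺ (tailOf S) ↭X)) (vdistinct X))

    uniqueEdges : Unique (edgesOf S A ++ edgesOf S B)
    uniqueEdges = ≡.subst Unique (map-++ proj₁ A B) (Unique-resp-↭ (↭-sym (↭ₚ.map⁺ proj₁ ↭X)) (edistinct X))

    tails⊆ : ∀ {v} → v ∈ tails A ++ tails B → v ∈ cycVerts S X
    tails⊆ v∈ = ∈-resp-↭ (↭ₚ.map⁺ (tailOf S) ↭X) (≡.subst (_ ∈_) (sym (map-++ (tailOf S) A B)) v∈)

    edges⊆ : ∀ {e} → e ∈ edgesOf S A ++ edgesOf S B → e ∈ cycEdges S X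
    edges⊆ e∈ = ∈-resp-↭ (↭ₚ.map⁺ proj₁ ↭X) (≡.subst (_ ∈_) (sym (map-++ proj₁ A B)) e∈)

    uniqueTails-A∷q : Unique (tails A ++ [ q ])
    uniqueTails-A∷q = Unique.++⁺ (proj₁ (Unique-++⁻ (tails A) uniqueTails)) ([] ∷ [])
      λ { (v∈A , here refl) → proj₂ (proj₂ (Unique-++⁻ (tails A) uniqueTails)) (v∈A , q∈B) }

    uniqueTails-B∷p : Unique (tails B ++ [ p ])
    uniqueTails-B∷p = Unique.++⁺ (proj₁ (proj₂ (Unique-++⁻ (tails A) uniqueTails))) ([] ∷ [])
      λ { (v∈B , here refl) → proj₂ (proj₂ (Unique-++⁻ (tails A) uniqueTails)) (p∈A , v∈B) }

    signProd-AB : signProd S A · signProd S B ≡ signProd S (steps X)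
    signProd-AB = trans (sym (signProd-++ A B)) (signProd-↭ ↭X)

module Coboundary {c ℓ} (G : AbelianGroup c ℓ) (S : SignedGraph) (ω : Orientation S) where
  open AbelianGroup G
  open CommutativeSemigroupProperties commutativeSemigroup using (interchange)
  open SignAction G
  open Walks S

  E : Set
  E = Fin (nE S)

  -- A record rather than an equation, so that g and f can be inferred from its type.
  record Matches (g : V → Carrier) (f : E → Carrier) (e : E) : Set ℓ where
    constructor matches
    field δ≈f : δ G S ω g e ≈ f e

  open Matches public

  Matches-cong : ∀ {g g′ f} e → g (end S e true) ≈ g′ (end S e true) → g (end S e false) ≈ g′ (end S e false) →
                 Matches g f e → Matches g′ f e
  Matches-cong e p q (matches m) = matches (trans (sym (∙-cong (act-cong (ω e true) p) (act-cong (ω e false) q))) m)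

  δ-at : ∀ g e b → δ G S ω g e ≈ act G (ω e b) (g (end S e b)) ∙ act G (ω e (not b)) (g (end S e (not b)))
  δ-at g e true  = refl
  δ-at g e false = comm _ _

  plainSum-cong : ∀ {f₁ f₂} → (∀ e → f₁ e ≈ f₂ e) → ∀ ss → plainSum G S ω f₁ ss ≈ plainSum G S ω f₂ ss
  plainSum-cong f₁≈f₂ []             = refl
  plainSum-cong f₁≈f₂ ((e , _) ∷ ss) = ∙-cong (f₁≈f₂ e) (plainSum-cong f₁≈f₂ ss)

  plainSum-δ : ∀ g {u w} ss → IsWalk S u ss w → plainSum G S ω (δ G S ω g) ss ≈₂ g u ∙ g w
  plainSum-δ g []             ≡.refl       = ≈₂-sym (double≈₂ε _)
  plainSum-δ g ((e , b) ∷ ss) (≡.refl , p) = ≈₂-trans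
    (∙-cong₂ (≈₂-trans (≈⇒≈₂ (δ-at g e b)) (∙-cong₂ (act≈₂ (ω e b) _) (act≈₂ (ω e (not b)) _))) (plainSum-δ g ss p))
    (≈₂-trans (≈⇒≈₂ (trans (∙-congˡ (comm _ _)) (interchange _ _ _ _))) (≈₂-sym (_ , refl)))

  InImageδ⇒closedWalk-In2G : ∀ {f} → InImageδ G S ω f → ∀ {v} ss → IsWalk S v ss v → In2G G (plainSum G S ω f ss)
  InImageδ⇒closedWalk-In2G (g , δg≈f) ss closed = ≈₂ε⇒In2G (≈₂-trans
    (≈⇒≈₂ (plainSum-cong (λ e → sym (δg≈f e)) ss)) (≈₂-trans (plainSum-δ g ss closed) (double≈₂ε _)))

module Tension {c ℓ} (G : AbelianGroup c ℓ) (S : SignedGraph) (ω : Orientation S) (compatible : Compatible S ω) where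
  open AbelianGroup G
  open AbelianGroupProperties G using (x∙y⁻¹≈ε⇒x≈y)
  open CommutativeSemigroupProperties commutativeSemigroup using (interchange)
  open SetoidReasoning setoid
  open SignAction G
  open Walks S
  open Coboundary G S ω

  compatibleAt : ∀ e b → sign S e ≡ opposite (ω e b · ω e (not b))
  compatibleAt e true  = ≡.trans (compatible e) (cong opposite (Sign.*-comm (ω e false) (ω e true)))
  compatibleAt e false = compatible e

  ω·sign≡opposite[ω] : ∀ e b → ω e b · sign S e ≡ opposite (ω e (not b))
  ω·sign≡opposite[ω] e b = ≡.trans (cong (ω e b ·_) (compatibleAt e b)) (a·opposite[a·c]≡opposite[c] (ω e b) (ω e (not b)))
    where
    a·opposite[a·c]≡opposite[c] : ∀ a c → a · opposite (a · c) ≡ opposite c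
    a·opposite[a·c]≡opposite[c] Sign.+ _      = ≡.refl
    a·opposite[a·c]≡opposite[c] Sign.- Sign.+ = ≡.refl
    a·opposite[a·c]≡opposite[c] Sign.- Sign.- = ≡.refl

  Matches-fromEnd : ∀ {g f} e b → g (end S e b) ≈ act G (ω e b) (f e) ∙ act G (sign S e) (g (end S e (not b))) →
                    Matches g f e
  Matches-fromEnd {g} {f} e b hyp = matches (begin
    δ G S ω g e                                   ≈⟨ δ-at g e b ⟩
    act G ω₁ (g x) ∙ act G ω₂ (g y)               ≈⟨ ∙-congʳ (act-cong ω₁ hyp) ⟩
    act G ω₁ (act G ω₁ (f e) ∙ act G σ (g y)) ∙ act G ω₂ (g y)
      ≈⟨ ∙-congʳ (trans (act-∙ ω₁ _ _) (∙-cong (act-involutive ω₁ (f e)) (sym (act-· ω₁ σ _)))) ⟩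
    (f e ∙ act G (ω₁ · σ) (g y)) ∙ act G ω₂ (g y)
      ≈⟨ ∙-congʳ (∙-congˡ (trans (reflexive (cong (λ t → act G t (g y)) (ω·sign≡opposite[ω] e b))) (act-opposite ω₂ _))) ⟩
    (f e ∙ act G ω₂ (g y) ⁻¹) ∙ act G ω₂ (g y)   ≈⟨ assoc _ _ _ ⟩
    f e ∙ (act G ω₂ (g y) ⁻¹ ∙ act G ω₂ (g y))   ≈⟨ ∙-congˡ (inverseˡ _) ⟩
    f e ∙ ε                                       ≈⟨ identityʳ (f e) ⟩
    f e                                           ∎)
    where
    x y : V
    x = end S e b
    y = end S e (not b)
    ω₁ ω₂ σ : Sign
    ω₁ = ω e b
    ω₂ = ω e (not b)
    σ = sign S e

  Matches-fromStart : ∀ {g f} e b → g (end S e (not b)) ≈ act G (sign S e) (g (end S e b)) ∙ act G (ω e (not b)) (f e) →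
                      Matches g f e
  Matches-fromStart {g} {f} e b hyp = Matches-fromEnd e (not b) (trans hyp (trans (comm _ _)
    (reflexive (cong (λ b′ → act G (ω e (not b)) (f e) ∙ act G (sign S e) (g (end S e b′))) (≡.sym (not-involutive b))))))

  private
    τ : (E → Carrier) → Sign → List (Step S) → Carrier
    τ = tensionSumFrom G S ω

  tensionSumFrom-linear : ∀ {f f₁ f₂} → (∀ e → f e ≈ f₁ e ∙ f₂ e) → ∀ s ss → τ f s ss ≈ τ f₁ s ss ∙ τ f₂ s ss
  tensionSumFrom-linear split s []             = sym (identityˡ ε)
  tensionSumFrom-linear split s ((e , b) ∷ ss) = trans
    (∙-cong (trans (act-cong (ω e b · s) (split e)) (act-∙ (ω e b · s) _ _)) (tensionSumFrom-linear split (s · sign S e) ss))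
    (interchange _ _ _ _)

  tensionSumFrom-δ-step : ∀ g s e b → act G (ω e b · s) (δ G S ω g e) ≈
                          act G s (g (end S e b)) ∙ act G (s · sign S e) (g (end S e (not b))) ⁻¹
  tensionSumFrom-δ-step g s e b = begin
    act G (ω₁ · s) (δ G S ω g e)
      ≈⟨ trans (act-cong (ω₁ · s) (δ-at g e b)) (act-∙ (ω₁ · s) _ _) ⟩
    act G (ω₁ · s) (act G ω₁ (g x)) ∙ act G (ω₁ · s) (act G ω₂ (g y))
      ≈⟨ ∙-cong (act-· (ω₁ · s) ω₁ _) (act-· (ω₁ · s) ω₂ _) ⟨
    act G ((ω₁ · s) · ω₁) (g x) ∙ act G ((ω₁ · s) · ω₂) (g y)
      ≡⟨ cong₂ (λ t t′ → act G t (g x) ∙ act G t′ (g y)) (ab·a≡b ω₁ s)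
               (≡.trans (ab·c≡opposite[b·opposite[a·c]] ω₁ s ω₂) (cong (λ σ → opposite (s · σ)) (≡.sym (compatibleAt e b)))) ⟩
    act G s (g x) ∙ act G (opposite (s · sign S e)) (g y)
      ≈⟨ ∙-congˡ (act-opposite (s · sign S e) _) ⟩
    act G s (g x) ∙ act G (s · sign S e) (g y) ⁻¹ ∎
    where
    x y : V
    x = end S e b
    y = end S e (not b)
    ω₁ ω₂ : Sign
    ω₁ = ω e b
    ω₂ = ω e (not b)
    ab·a≡b : ∀ a b → (a · b) · a ≡ b
    ab·a≡b Sign.+ Sign.+ = ≡.refl
    ab·a≡b Sign.+ Sign.- = ≡.refl
    ab·a≡b Sign.- Sign.+ = ≡.refl
    ab·a≡b Sign.- Sign.- = ≡.refl
    ab·c≡opposite[b·opposite[a·c]] : ∀ a b c → (a · b) · c ≡ opposite (b · opposite (a · c))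
    ab·c≡opposite[b·opposite[a·c]] Sign.+ Sign.+ Sign.+ = ≡.refl
    ab·c≡opposite[b·opposite[a·c]] Sign.+ Sign.+ Sign.- = ≡.refl
    ab·c≡opposite[b·opposite[a·c]] Sign.+ Sign.- Sign.+ = ≡.refl
    ab·c≡opposite[b·opposite[a·c]] Sign.+ Sign.- Sign.- = ≡.refl
    ab·c≡opposite[b·opposite[a·c]] Sign.- Sign.+ Sign.+ = ≡.refl
    ab·c≡opposite[b·opposite[a·c]] Sign.- Sign.+ Sign.- = ≡.refl
    ab·c≡opposite[b·opposite[a·c]] Sign.- Sign.- Sign.+ = ≡.refl
    ab·c≡opposite[b·opposite[a·c]] Sign.- Sign.- Sign.- = ≡.refl

  tensionSumFrom-δ : ∀ g s {u w} ss → IsWalk S u ss w →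
                     τ (δ G S ω g) s ss ≈ act G s (g u) ∙ act G (s · signProd S ss) (g w) ⁻¹
  tensionSumFrom-δ g s {u} [] ≡.refl = begin
    ε                                         ≈⟨ inverseʳ _ ⟨
    act G s (g u) ∙ act G s (g u) ⁻¹          ≡⟨ cong (λ t → act G s (g u) ∙ act G t (g u) ⁻¹) (≡.sym (Sign.*-identityʳ s)) ⟩
    act G s (g u) ∙ act G (s · Sign.+) (g u) ⁻¹ ∎
  tensionSumFrom-δ g s {w = w} ((e , b) ∷ ss) (≡.refl , p) = begin
    act G (ω e b · s) (δ G S ω g e) ∙ τ (δ G S ω g) (s · sign S e) ss
      ≈⟨ ∙-cong (tensionSumFrom-δ-step g s e b) (tensionSumFrom-δ g (s · sign S e) ss p) ⟩
    (a ∙ m ⁻¹) ∙ (m ∙ act G ((s · sign S e) · signProd S ss) (g w) ⁻¹)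
      ≈⟨ telescope a m _ ⟩
    a ∙ act G ((s · sign S e) · signProd S ss) (g w) ⁻¹
      ≡⟨ cong (λ t → a ∙ act G t (g w) ⁻¹) (Sign.*-assoc s (sign S e) _) ⟩
    a ∙ act G (s · (sign S e · signProd S ss)) (g w) ⁻¹ ∎
    where
    a m : Carrier
    a = act G s (g (end S e b))
    m = act G (s · sign S e) (g (end S e (not b)))
    telescope : ∀ x y z → (x ∙ y ⁻¹) ∙ (y ∙ z) ≈ x ∙ z
    telescope x y z = begin
      (x ∙ y ⁻¹) ∙ (y ∙ z)   ≈⟨ interchange x _ y z ⟩
      (x ∙ y) ∙ (y ⁻¹ ∙ z)   ≈⟨ assoc x y _ ⟩
      x ∙ (y ∙ (y ⁻¹ ∙ z))   ≈⟨ ∙-congˡ (assoc y _ z) ⟨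
      x ∙ ((y ∙ y ⁻¹) ∙ z)   ≈⟨ ∙-congˡ (trans (∙-congʳ (inverseʳ y)) (identityˡ z)) ⟩
      x ∙ z                  ∎

  tensionSumFrom-vanishing : ∀ {h} s ss → All (λ st → h (proj₁ st) ≈ ε) ss → τ h s ss ≈ ε
  tensionSumFrom-vanishing s []             []       = refl
  tensionSumFrom-vanishing s ((e , b) ∷ ss) (z ∷ zs) =
    trans (∙-cong (trans (act-cong (ω e b · s) z) (act-ε (ω e b · s))) (tensionSumFrom-vanishing _ ss zs)) (identityʳ ε)

  tensionSumFrom-single : ∀ {h} e s ss → All (λ st → proj₁ st ≡ e ⊎ h (proj₁ st) ≈ ε) ss → occ S e ss ≡ 1 →
                          ∃[ t ] τ h s ss ≈ act G t (h e)
  tensionSumFrom-single {h} e s ((e′ , b) ∷ ss) (z ∷ zs) once with e ≟ e′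
  ... | yes ≡.refl = ω e b · s , trans (∙-congˡ (tensionSumFrom-vanishing _ ss (vanishing ss zs (cong pred once)))) (identityʳ _)
    where
    vanishing : ∀ ts → All (λ st → proj₁ st ≡ e ⊎ h (proj₁ st) ≈ ε) ts → occ S e ts ≡ 0 → All (λ st → h (proj₁ st) ≈ ε) ts
    vanishing []               []              _ = []
    vanishing ((e″ , _) ∷ ts)  (z′ ∷ zs′) none with e ≟ e″
    vanishing ((e″ , _) ∷ ts)  (z′ ∷ zs′) () | yes _
    vanishing ((e″ , _) ∷ ts)  (inj₁ e″≡e ∷ zs′) none | no e≢e″ = ⊥-elim (e≢e″ (≡.sym e″≡e))
    vanishing ((e″ , _) ∷ ts)  (inj₂ z′ ∷ zs′) none | no _ = z′ ∷ vanishing ts zs′ none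
  ... | no e≢e′ with z
  ...   | inj₁ e′≡e = ⊥-elim (e≢e′ (≡.sym e′≡e))
  ...   | inj₂ z′ with tensionSumFrom-single e (s · sign S e′) ss zs once
  ...     | t , p = t , trans (∙-cong (trans (act-cong (ω e′ b · s) z′) (act-ε (ω e′ b · s))) p) (identityˡ _)

  -- With h = f - δg: τ (δ g) telescopes to ε on a balanced closed walk, and τ h = ±h(e) since h vanishes off e.
  Matches-fromBalancedWalk : ∀ {f g} e {v} ss → IsWalk S v ss v → signProd S ss ≡ Sign.+ → tensionSum G S ω f ss ≈ ε →
                             occ S e ss ≡ 1 → All (λ st → proj₁ st ≡ e ⊎ Matches g f (proj₁ st)) ss → Matches g f e
  Matches-fromBalancedWalk {f} {g} e {v} ss closed balanced vanishes once others = matches $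
    sym (x∙y⁻¹≈ε⇒x≈y _ _ (act≈ε⇒≈ε t (trans (sym τh≈) τh≈ε)))
    where
    h : E → Carrier
    h e′ = f e′ ∙ δ G S ω g e′ ⁻¹
    f≈δg∙h : ∀ e′ → f e′ ≈ δ G S ω g e′ ∙ h e′
    f≈δg∙h e′ = begin
      f e′                                 ≈⟨ identityˡ _ ⟨
      ε ∙ f e′                             ≈⟨ ∙-congʳ (inverseʳ _) ⟨
      (δ G S ω g e′ ∙ δ G S ω g e′ ⁻¹) ∙ f e′ ≈⟨ assoc _ _ _ ⟩
      δ G S ω g e′ ∙ (δ G S ω g e′ ⁻¹ ∙ f e′) ≈⟨ ∙-congˡ (comm _ _) ⟩
      δ G S ω g e′ ∙ h e′                  ∎
    τδg≈ε : τ (δ G S ω g) Sign.+ ss ≈ ε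
    τδg≈ε = trans (tensionSumFrom-δ g Sign.+ ss closed)
      (trans (reflexive (cong (λ t → g v ∙ act G t (g v) ⁻¹) balanced)) (inverseʳ (g v)))
    τh≈ε : τ h Sign.+ ss ≈ ε
    τh≈ε = begin
      τ h Sign.+ ss                              ≈⟨ identityˡ _ ⟨
      ε ∙ τ h Sign.+ ss                          ≈⟨ ∙-congʳ τδg≈ε ⟨
      τ (δ G S ω g) Sign.+ ss ∙ τ h Sign.+ ss    ≈⟨ tensionSumFrom-linear f≈δg∙h Sign.+ ss ⟨
      τ f Sign.+ ss                              ≈⟨ vanishes ⟩
      ε                                          ∎
    hVanishes : ∀ {st : Step S} → proj₁ st ≡ e ⊎ Matches g f (proj₁ st) → proj₁ st ≡ e ⊎ h (proj₁ st) ≈ ε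
    hVanishes (inj₁ p) = inj₁ p
    hVanishes (inj₂ m) = inj₂ (trans (∙-congʳ (sym (δ≈f m))) (inverseʳ _))
    single : ∃[ t ] τ h Sign.+ ss ≈ act G t (h e)
    single = tensionSumFrom-single {h} e Sign.+ ss (All.map (λ {st} → hVanishes {st}) others) once
    t : Sign
    t = proj₁ single
    τh≈ : τ h Sign.+ ss ≈ act G t (h e)
    τh≈ = proj₂ single

module CycleValues {c ℓ} (G : AbelianGroup c ℓ) (S : SignedGraph) (ω : Orientation S) (compatible : Compatible S ω)
                   (f : Fin (nE S) → AbelianGroup.Carrier G) where
  open AbelianGroup G
  open SetoidReasoning setoid
  open SignAction G
  open Walks S
  open Coboundary G S ω
  open Tension G S ω compatible

  -- The value at the head of a step forced by δg = f on its edge, given the value z at its tail.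
  transport : Step S → Carrier → Carrier
  transport (e , b) z = act G (sign S e) z ∙ act G (ω e (not b)) (f e)

  transportAlong : Carrier → List (Step S) → Carrier
  transportAlong z []       = z
  transportAlong z (s ∷ ss) = transportAlong (transport s z) ss

  assignAlong : Carrier → List (Step S) → V → Carrier
  assignAlong z []       v = z
  assignAlong z (s ∷ ss) v with tailOf S s ≟ v
  ... | yes _ = z
  ... | no _  = assignAlong (transport s z) ss v

  Consistent : (V → Carrier) → Carrier → V → List (Step S) → Set ℓ
  Consistent g z v []       = g v ≈ z
  Consistent g z v (s ∷ ss) = g v ≈ z × Consistent g (transport s z) (headOf S s) ss

  Consistent-head : ∀ {g z v} ss → Consistent g z v ss → g v ≈ z
  Consistent-head []      c       = c
  Consistent-head (_ ∷ _) (c , _) = c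

  Consistent⇒Matches : ∀ {g z u w} ss → IsWalk S u ss w → Consistent g z u ss → All (λ s → Matches g f (proj₁ s)) ss
  Consistent⇒Matches []             _            _         = []
  Consistent⇒Matches ((e , b) ∷ ss) (≡.refl , p) (gu≈z , c) =
    Matches-fromStart e b (trans (Consistent-head ss c) (∙-congʳ (act-cong (sign S e) (sym gu≈z)))) ∷ Consistent⇒Matches ss p c

  transportAlong-++ : ∀ z ss ts → transportAlong z (ss ++ ts) ≡ transportAlong (transportAlong z ss) ts
  transportAlong-++ z []       ts = ≡.refl
  transportAlong-++ z (s ∷ ss) ts = transportAlong-++ (transport s z) ss ts

  assignAlong-++-∉ : ∀ z ss ts v → v ∉ tails ss → assignAlong z (ss ++ ts) v ≡ assignAlong (transportAlong z ss) ts v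
  assignAlong-++-∉ z []       ts v v∉ = ≡.refl
  assignAlong-++-∉ z (s ∷ ss) ts v v∉ with tailOf S s ≟ v
  ... | yes t≡v = ⊥-elim (v∉ (here (≡.sym t≡v)))
  ... | no _    = assignAlong-++-∉ (transport s z) ss ts v (λ v∈ → v∉ (there v∈))

  assignAlong-consistent : ∀ y ss ts {u w} → IsWalk S u ts w → Unique (tails (ss ++ ts)) →
                           assignAlong y (ss ++ ts) w ≈ transportAlong y (ss ++ ts) →
                           Consistent (assignAlong y (ss ++ ts)) (transportAlong y ss) u ts
  assignAlong-consistent y ss [] {u} ≡.refl _ closes =
    ≡.subst (λ zs → assignAlong y (ss ++ []) u ≈ transportAlong y zs) (++-identityʳ ss) closes
  assignAlong-consistent y ss (t ∷ ts) {u} (t≡u , p) unique closes = atU , rest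
    where
    u∉ss : u ∉ tails ss
    u∉ss u∈ss = proj₂ (proj₂ (Unique-++⁻ (tails ss) (≡.subst Unique (map-++ (tailOf S) ss (t ∷ ts)) unique)))
                  (u∈ss , here (≡.sym t≡u))
    atU : assignAlong y (ss ++ t ∷ ts) u ≈ transportAlong y ss
    atU rewrite assignAlong-++-∉ y ss (t ∷ ts) u u∉ss with tailOf S t ≟ u
    ... | yes _   = refl
    ... | no t≢u  = ⊥-elim (t≢u t≡u)
    shift : (ss ++ [ t ]) ++ ts ≡ ss ++ t ∷ ts
    shift = ++-assoc ss [ t ] ts
    rest : Consistent (assignAlong y (ss ++ t ∷ ts)) (transport t (transportAlong y ss)) (headOf S t) ts
    rest = ≡.subst₂ (λ zs z → Consistent (assignAlong y zs) z (headOf S t) ts) shift (transportAlong-++ y ss [ t ])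
      (assignAlong-consistent y (ss ++ [ t ]) ts p (≡.subst (λ zs → Unique (tails zs)) (≡.sym shift) unique)
        (≡.subst (λ zs → assignAlong y zs _ ≈ transportAlong y zs) (≡.sym shift) closes))

  transportAlong≈₂ : ∀ z ss → transportAlong z ss ≈₂ z ∙ plainSum G S ω f ss
  transportAlong≈₂ z []             = ≈⇒≈₂ (sym (identityʳ z))
  transportAlong≈₂ z ((e , b) ∷ ss) = ≈₂-trans (transportAlong≈₂ _ ss)
    (≈₂-trans (∙-cong₂ (∙-cong₂ (act≈₂ (sign S e) z) (act≈₂ (ω e (not b)) (f e))) (≈⇒≈₂ refl)) (≈⇒≈₂ (assoc z (f e) _)))

  transportAlong-affine : ∀ z ss → transportAlong z ss ≈ act G (signProd S ss) z ∙ transportAlong ε ss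
  transportAlong-affine z []             = sym (identityʳ z)
  transportAlong-affine z ((e , b) ∷ ss) = begin
    transportAlong (σ z ∙ φ) ss                 ≈⟨ transportAlong-affine _ ss ⟩
    act G π (σ z ∙ φ) ∙ transportAlong ε ss     ≈⟨ ∙-congʳ (act-∙ π _ _) ⟩
    (act G π (σ z) ∙ act G π φ) ∙ transportAlong ε ss
      ≈⟨ assoc _ _ _ ⟩
    act G π (σ z) ∙ (act G π φ ∙ transportAlong ε ss)
      ≈⟨ ∙-cong (act-· π (sign S e) z) (trans (transportAlong-affine _ ss)
                                              (∙-congʳ (act-cong π (trans (∙-congʳ (act-ε (sign S e))) (identityˡ φ))))) ⟨
    act G (π · sign S e) z ∙ transportAlong (σ ε ∙ φ) ss
      ≡⟨ cong (λ t → act G t z ∙ transportAlong (σ ε ∙ φ) ss) (Sign.*-comm π (sign S e)) ⟩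
    act G (sign S e · π) z ∙ transportAlong (σ ε ∙ φ) ss ∎
    where
    π : Sign
    π = signProd S ss
    σ : Carrier → Carrier
    σ = act G (sign S e)
    φ : Carrier
    φ = act G (ω e (not b)) (f e)

  -- Around an unbalanced walk, transport is y ↦ c - y with c ≡ Σ f modulo 2G; a half of c is a fixed point.
  unbalanced-fixedPoint : ∀ ss → signProd S ss ≡ Sign.- → In2G G (plainSum G S ω f ss) → ∃[ y ] transportAlong y ss ≈ y
  unbalanced-fixedPoint ss negative sum∈2G with ≈₂ε⇒In2G (≈₂-trans (transportAlong≈₂ ε ss)
                                                 (≈₂-trans (≈⇒≈₂ (identityˡ _)) (In2G⇒≈₂ε sum∈2G)))
  ... | y , y∙y≈c = y , (begin
    transportAlong y ss                           ≈⟨ transportAlong-affine y ss ⟩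
    act G (signProd S ss) y ∙ transportAlong ε ss ≡⟨ cong (λ t → act G t y ∙ transportAlong ε ss) negative ⟩
    y ⁻¹ ∙ transportAlong ε ss                    ≈⟨ ∙-congˡ y∙y≈c ⟨
    y ⁻¹ ∙ (y ∙ y)                                ≈⟨ assoc _ _ _ ⟨
    (y ⁻¹ ∙ y) ∙ y                                ≈⟨ ∙-congʳ (inverseˡ y) ⟩
    ε ∙ y                                         ≈⟨ identityˡ y ⟩
    y                                             ∎)

  unbalancedCycle-values : (U : Cycle S) → Unbalanced S U → In2G G (plainSum G S ω f (steps U)) →
                           ∃[ y ] All (λ s → Matches (assignAlong y (steps U)) f (proj₁ s)) (steps U)
  unbalancedCycle-values U unbalanced sum∈2G with unbalanced-fixedPoint (steps U) negative sum∈2G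
    where
    negative : signProd S (steps U) ≡ Sign.-
    negative with signProd S (steps U)
    ... | Sign.- = ≡.refl
    ... | Sign.+ = ⊥-elim (unbalanced ≡.refl)
  ... | y , fixed = y , Consistent⇒Matches (steps U) (closed U) (assignAlong-consistent y [] (steps U) (closed U) (vdistinct U)
                          (trans (reflexive (assignAlong-start (steps U) (closed U) (nonempty U))) (sym fixed)))
    where
    assignAlong-start : ∀ ss {u w} → IsWalk S u ss w → NonEmpty S ss → assignAlong y ss u ≡ y
    assignAlong-start (s ∷ ss) {u} (t≡u , _) _ with tailOf S s ≟ u
    ... | yes _  = ≡.refl
    ... | no t≢u = ⊥-elim (t≢u t≡u)

record RootedForest (S : SignedGraph) : Set where
  field
    depth          : Fin (nV S) → ℕ
    parent         : Fin (nV S) → Maybe (Step S)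
    parent-just    : ∀ v s → parent v ≡ just s → tailOf S s ≡ v × suc (depth (headOf S s)) ≡ depth v
    parent-nothing : ∀ v → parent v ≡ nothing → depth v ≡ 0

module Reachability (S : SignedGraph) where
  open ≡ using (refl; sym; trans)
  open Walks S using (V)

  StepInto : (V → Bool) → V → Step S → Set
  StepInto A v s = tailOf S s ≡ v × A (headOf S s) ≡ true

  stepInto? : ∀ A v → Dec (∃ (StepInto A v))
  stepInto? A v with any? (λ e → stepInto₁? (e , false) ⊎-dec stepInto₁? (e , true))
    where
    stepInto₁? : ∀ s → Dec (StepInto A v s)
    stepInto₁? s = (tailOf S s Fin.≟ v) ×-dec (A (headOf S s) Data.Bool.Properties.≟ true)
  ... | yes (e , inj₁ p) = yes ((e , false) , p)
  ... | yes (e , inj₂ p) = yes ((e , true) , p)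
  ... | no ¬p = no λ { ((e , false) , p) → ¬p (e , inj₁ p) ; ((e , true) , p) → ¬p (e , inj₂ p) }

  hasStepInto : (V → Bool) → V → Bool
  hasStepInto A v = does (stepInto? A v)

  hasStepInto-intro : ∀ A v s → StepInto A v s → hasStepInto A v ≡ true
  hasStepInto-intro A v s p with stepInto? A v
  ... | yes _ = refl
  ... | no ¬p = ⊥-elim (¬p (s , p))

  hasStepInto-elim : ∀ A v → hasStepInto A v ≡ true → ∃ (StepInto A v)
  hasStepInto-elim A v _  with stepInto? A v
  hasStepInto-elim A v _  | yes p = p
  hasStepInto-elim A v () | no _

  hasStepInto-cong : ∀ {A B} → (∀ u → A u ≡ B u) → ∀ v → hasStepInto A v ≡ hasStepInto B v
  hasStepInto-cong {A} {B} A≗B v with stepInto? A v | stepInto? B v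
  ... | yes _ | yes _ = refl
  ... | no _  | no _  = refl
  ... | yes (s , t , a) | no ¬b = ⊥-elim (¬b (s , t , trans (sym (A≗B _)) a))
  ... | no ¬a | yes (s , t , b) = ⊥-elim (¬a (s , t , trans (A≗B _) b))

  module Closure (R₀ : V → Bool) where
    open import Data.Bool using (_∨_)
    open import Data.Fin.Subset using (Subset; _⊂_; ∣_∣)
    open import Data.Fin.Subset.Properties using (p⊂q⇒∣p∣<∣q∣; ∣p∣≤n)
    open import Data.Vec using (tabulate)
    open import Data.Vec.Properties using (lookup∘tabulate; []=⇒lookup; lookup⇒[]=)

    private
      true≢false : true ≢ false
      true≢false ()

    reach : ℕ → V → Bool
    reach zero    v = R₀ v
    reach (suc k) v = reach k v ∨ hasStepInto (reach k) v

    reach-suc : ∀ k v → reach k v ≡ true → reach (suc k) v ≡ true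
    reach-suc k v r rewrite r = refl

    reach-mono : ∀ {k m} v → k ≤ m → reach k v ≡ true → reach m v ≡ true
    reach-mono {k} v k≤m r with ℕ.≤⇒≤′ k≤m
    ... | Data.Nat.≤′-refl             = r
    ... | Data.Nat.≤′-step {m′} k≤′m′  = reach-suc m′ v (reach-mono {k} {m′} v (ℕ.≤′⇒≤ k≤′m′) r)

    reach-step : ∀ k s → reach k (headOf S s) ≡ true → reach (suc k) (tailOf S s) ≡ true
    reach-step k s r rewrite hasStepInto-intro (reach k) (tailOf S s) s (refl , r) = Data.Bool.Properties.∨-zeroʳ _

    Stable : ℕ → Set
    Stable k = ∀ v → reach (suc k) v ≡ reach k v

    reachSet : ℕ → Subset (nV S)
    reachSet k = tabulate (reach k)

    reachSet-grows : ∀ k → ¬ Stable k → reachSet k ⊂ reachSet (suc k)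
    reachSet-grows k unstable with ¬∀⟶∃¬ (nV S) _ (λ v → reach (suc k) v Data.Bool.Properties.≟ reach k v) unstable
    ... | v , changed = (λ {u} u∈ → toSet (suc k) u (reach-suc k u (fromSet k u u∈)))
                        , v , toSet (suc k) v new , λ v∈ → changed (trans new (sym (fromSet k v v∈)))
      where
      toSet : ∀ k v → reach k v ≡ true → v Data.Fin.Subset.∈ reachSet k
      toSet k v r = lookup⇒[]= v (reachSet k) (trans (lookup∘tabulate (reach k) v) r)
      fromSet : ∀ k v → v Data.Fin.Subset.∈ reachSet k → reach k v ≡ true
      fromSet k v v∈ = trans (sym (lookup∘tabulate (reach k) v)) ([]=⇒lookup v∈)
      new : reach (suc k) v ≡ true
      new = grown (reach-suc k v) changed
        where
        grown : ∀ {a b : Bool} → (a ≡ true → b ≡ true) → b ≢ a → b ≡ true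
        grown {true}          a⇒b _   = a⇒b refl
        grown {false} {true}  _   _   = refl
        grown {false} {false} _   b≢a = ⊥-elim (b≢a refl)

    stabilises-or-grows : ∀ k → (∃[ j ] j < k × Stable j) ⊎ k ≤ ∣ reachSet k ∣
    stabilises-or-grows zero = inj₂ z≤n
    stabilises-or-grows (suc k) with stabilises-or-grows k
    ... | inj₁ (j , j<k , stable) = inj₁ (j , ℕ.m≤n⇒m≤1+n j<k , stable)
    ... | inj₂ k≤∣reach∣ with all? (λ v → reach (suc k) v Data.Bool.Properties.≟ reach k v)
    ...   | yes stable  = inj₁ (k , ≤-refl , stable)
    ...   | no unstable = inj₂ (≤-trans (s≤s k≤∣reach∣) (p⊂q⇒∣p∣<∣q∣ (reachSet-grows k unstable)))

    Stable-persistent : ∀ {j} → Stable j → ∀ {m} → j ≤ m → ∀ v → reach m v ≡ reach j v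
    Stable-persistent {j} stable {m} j≤m v with ℕ.≤⇒≤′ j≤m
    ... | Data.Nat.≤′-refl             = refl
    ... | Data.Nat.≤′-step {m′} j≤′m′ = begin
      reach m′ v ∨ hasStepInto (reach m′) v
        ≡⟨ cong₂ _∨_ (Stable-persistent stable (ℕ.≤′⇒≤ j≤′m′) v)
                      (hasStepInto-cong (Stable-persistent stable (ℕ.≤′⇒≤ j≤′m′)) v) ⟩
      reach j v ∨ hasStepInto (reach j) v
        ≡⟨ stable v ⟩
      reach j v ∎
      where open ≡.≡-Reasoning

    reach-stable : ∀ v → reach (suc (nV S)) v ≡ reach (nV S) v
    reach-stable v with stabilises-or-grows (suc (nV S))
    ... | inj₂ n<∣reach∣ = ⊥-elim (<-irrefl refl (≤-trans n<∣reach∣ (∣p∣≤n (reachSet (suc (nV S))))))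
    ... | inj₁ (j , j<1+n , stable) =
      trans (Stable-persistent stable (ℕ.m≤n⇒m≤1+n (ℕ.≤-pred j<1+n)) v) (sym (Stable-persistent stable (ℕ.≤-pred j<1+n) v))

    Reached : V → Set
    Reached v = reach (nV S) v ≡ true

    Reached-root : ∀ v → R₀ v ≡ true → Reached v
    Reached-root v r = reach-mono {0} {nV S} v z≤n r

    Reached-step : ∀ s → Reached (headOf S s) → Reached (tailOf S s)
    Reached-step s r = trans (sym (reach-stable _)) (reach-step (nV S) s r)

    reach-induction : (C : V → Set) → (∀ v → R₀ v ≡ true → C v) → (∀ s → C (headOf S s) → C (tailOf S s)) →
                      ∀ k v → reach k v ≡ true → C v
    reach-induction C root step zero    v r = root v r
    reach-induction C root step (suc k) v r with reach k v in r′
    ... | true  = reach-induction C root step k v r′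
    ... | false with hasStepInto-elim (reach k) v r
    ...   | s , refl , r″ = step s (reach-induction C root step k _ r″)

    Reached-induction : (C : V → Set) → (∀ v → R₀ v ≡ true → C v) → (∀ s → C (headOf S s) → C (tailOf S s)) →
                        ∀ v → Reached v → C v
    Reached-induction C root step = reach-induction C root step (nV S)

    -- Unreached vertices get depth 0 and no parent.
    depth : V → ℕ
    depth v = Data.Bool.if reach (nV S) v then leastTrue≤ (λ k → reach k v) (nV S) else 0

    depth-Reached : ∀ v → Reached v → depth v ≡ leastTrue≤ (λ k → reach k v) (nV S)
    depth-Reached v r rewrite r = refl

    depth≡suc⇒Reached : ∀ v k → depth v ≡ suc k → Reached v
    depth≡suc⇒Reached v k d≡ with reach (nV S) v
    ... | true = refl
    depth≡suc⇒Reached v k () | false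

    depth≤n : ∀ v → depth v ≤ nV S
    depth≤n v with reach (nV S) v
    ... | true  = leastTrue≤-≤ _ (nV S)
    ... | false = z≤n

    reach-depth : ∀ v → Reached v → reach (depth v) v ≡ true
    reach-depth v r rewrite depth-Reached v r = leastTrue≤-true (λ k → reach k v) (nV S) r

    reach<depth : ∀ v j → Reached v → j < depth v → reach j v ≡ false
    reach<depth v j r j< rewrite depth-Reached v r = leastTrue≤-minimal (λ k → reach k v) (nV S) j j<

    depth-≤ : ∀ v k → reach k v ≡ true → depth v ≤ k
    depth-≤ v k r with ℕ.≤-total k (nV S)
    ... | inj₂ n≤k = ≤-trans (depth≤n v) n≤k
    ... | inj₁ k≤n = ℕ.≮⇒≥ λ k<d → true≢false (trans (sym r) (reach<depth v k (reach-mono v k≤n r) k<d))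

    depth≡0⇒root : ∀ v → Reached v → depth v ≡ 0 → R₀ v ≡ true
    depth≡0⇒root v r d≡0 = ≡.subst (λ k → reach k v ≡ true) d≡0 (reach-depth v r)

    root⇒depth≡0 : ∀ v → R₀ v ≡ true → depth v ≡ 0
    root⇒depth≡0 v r = ℕ.n≤0⇒n≡0 (depth-≤ v 0 r)

    parentAt : V → ℕ → Maybe (Step S)
    parentAt v zero    = nothing
    parentAt v (suc k) = Maybe.map proj₁ (dec⇒maybe (stepInto? (reach k) v))

    parent : V → Maybe (Step S)
    parent v = parentAt v (depth v)

    parent-just : ∀ v s → parent v ≡ just s →
                  tailOf S s ≡ v × suc (depth (headOf S s)) ≡ depth v × Reached (headOf S s)
    parent-just v s p≡s = go (depth v) refl p≡s
      where
      go : ∀ d → d ≡ depth v → parentAt v d ≡ just s →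
           tailOf S s ≡ v × suc (depth (headOf S s)) ≡ depth v × Reached (headOf S s)
      go (suc k) d≡ p≡s with stepInto? (reach k) v
      go (suc k) d≡ refl | yes (s , t≡v , rk) = t≡v , trans (cong suc depth≡k) d≡ , reachedHead
        where
        k<n : suc k ≤ nV S
        k<n = ≡.subst (_≤ nV S) (sym d≡) (depth≤n v)
        reachedHead : Reached (headOf S s)
        reachedHead = reach-mono _ (≤-trans (ℕ.n≤1+n k) k<n) rk
        depth≡k : depth (headOf S s) ≡ k
        depth≡k = ℕ.≤-antisym (depth-≤ _ k rk) (ℕ.≮⇒≥ λ j<k → true≢false
          (trans (sym (reachedEarlier j<k)) (reach<depth v k (depth≡suc⇒Reached v k (sym d≡)) (≡.subst (k <_) d≡ ≤-refl))))
          where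
          j : ℕ
          j = depth (headOf S s)
          reachedEarlier : j < k → reach k v ≡ true
          reachedEarlier j<k = reach-mono {suc j} {k} v j<k
            (≡.subst (λ u → reach (suc j) u ≡ true) t≡v (reach-step j s (reach-depth _ reachedHead)))
      go (suc k) d≡ () | no _

    parent-nothing : ∀ v → parent v ≡ nothing → depth v ≡ 0
    parent-nothing v = go (depth v) refl
      where
      go : ∀ d → d ≡ depth v → parentAt v d ≡ nothing → d ≡ 0
      go zero    _  _ = refl
      go (suc k) d≡ p≡nothing with stepInto? (reach k) v
      go (suc k) d≡ ()        | yes _
      go (suc k) d≡ _         | no ¬step = ⊥-elim (¬step (hasStepInto-elim (reach k) v (≡.subst (λ b → b ∨ hasStepInto (reach k) v ≡ true) rk rs)))
        where
        reached : Reached v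
        reached = depth≡suc⇒Reached v k (sym d≡)
        rs : reach (suc k) v ≡ true
        rs = ≡.subst (λ j → reach j v ≡ true) (sym d≡) (reach-depth v reached)
        rk : reach k v ≡ false
        rk = reach<depth v k reached (≡.subst (k <_) d≡ ≤-refl)

    parent-Reached : ∀ s → parent (tailOf S s) ≡ just s → Reached (headOf S s)
    parent-Reached s p = proj₂ (proj₂ (parent-just _ s p))

    forest : RootedForest S
    forest = record
      { depth          = depth
      ; parent         = parent
      ; parent-just    = λ v s p≡s → proj₁ (parent-just v s p≡s) , proj₁ (proj₂ (parent-just v s p≡s))
      ; parent-nothing = parent-nothing
      }

module Components (S : SignedGraph) where
  open ≡ using (refl; sym; trans)
  open Walks S using (V)
  open Reachability S

  isVertex : V → V → Bool
  isVertex u v = does (v ≟ u)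

  isVertex-refl : ∀ u → isVertex u u ≡ true
  isVertex-refl u with u ≟ u
  ... | yes _   = refl
  ... | no u≢u = ⊥-elim (u≢u refl)

  isVertex⇒≡ : ∀ u v → isVertex u v ≡ true → v ≡ u
  isVertex⇒≡ u v _  with v ≟ u
  isVertex⇒≡ u v _  | yes v≡u = v≡u
  isVertex⇒≡ u v () | no _

  module From (u : V) = Closure (isVertex u)

  Connected : V → V → Set
  Connected u = From.Reached u

  connected? : ∀ u v → Dec (Connected u v)
  connected? u v = From.reach u (nV S) v Data.Bool.Properties.≟ true

  Connected-refl : ∀ u → Connected u u
  Connected-refl u = From.Reached-root u u (isVertex-refl u)

  Connected-induction : ∀ u (C : V → Set) → C u → (∀ s → C (headOf S s) → C (tailOf S s)) → ∀ v → Connected u v → C v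
  Connected-induction u C Cu = From.Reached-induction u C (λ v v≡u → ≡.subst C (sym (isVertex⇒≡ u v v≡u)) Cu)

  Connected-trans : ∀ {u v w} → Connected u v → Connected v w → Connected u w
  Connected-trans {u} {v} {w} u~v = Connected-induction v (Connected u) u~v (From.Reached-step u) w

  Connected-step : ∀ s → Connected (tailOf S s) (headOf S s)
  Connected-step (e , b) = From.Reached-step (end S e b) (e , not b)
    (≡.subst (λ b′ → Connected (end S e b) (end S e b′)) (sym (not-involutive b)) (Connected-refl _))

  Connected-sym : ∀ {u v} → Connected u v → Connected v u
  Connected-sym {u} = Connected-induction u (λ v → Connected v u) (Connected-refl u)
    (λ s head~u → Connected-trans (Connected-step s) head~u) _

  representative : V → V
  representative v = Maybe.fromMaybe v (firstTrue (From.reach v (nV S)))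

  Connected-representative : ∀ v → Connected (representative v) v
  Connected-representative v with firstTrue-true (From.reach v (nV S)) v (Connected-refl v)
  ... | r , first≡r , v~r rewrite first≡r = Connected-sym v~r

  representative-step : ∀ s → representative (tailOf S s) ≡ representative (headOf S s)
  representative-step s = trans (cong (Maybe.fromMaybe _) (firstTrue-cong sameComponent)) (fromMaybe-irrelevant (headOf S s))
    where
    sameComponent : ∀ v → From.reach (tailOf S s) (nV S) v ≡ From.reach (headOf S s) (nV S) v
    sameComponent v = equivalent (Connected-trans (Connected-sym (Connected-step s))) (Connected-trans (Connected-step s))
      where
      equivalent : ∀ {a b : Bool} → (a ≡ true → b ≡ true) → (b ≡ true → a ≡ true) → a ≡ b
      equivalent {true}          a⇒b _   = sym (a⇒b refl)
      equivalent {false} {false} _   _   = refl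
      equivalent {false} {true}  _   b⇒a = b⇒a refl
    fromMaybe-irrelevant : ∀ w → Maybe.fromMaybe (tailOf S s) (firstTrue (From.reach w (nV S))) ≡ representative w
    fromMaybe-irrelevant w with firstTrue-true (From.reach w (nV S)) w (Connected-refl w)
    ... | r , first≡r , _ rewrite first≡r = refl

module ForestWalks {S : SignedGraph} (F : RootedForest S) where
  open ≡ using (refl; sym; trans)
  open Walks S
  open ClosedWalks S
  open RootedForest F

  IsParentStep : Step S → Set
  IsParentStep s = parent (tailOf S s) ≡ just s

  ParentWalk : List (Step S) → Set
  ParentWalk = All IsParentStep

  parentStep-depth : ∀ s → IsParentStep s → suc (depth (headOf S s)) ≡ depth (tailOf S s)
  parentStep-depth s p = proj₂ (parent-just _ s p)

  parent⇒IsParentStep : ∀ {v s} → parent v ≡ just s → IsParentStep s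
  parent⇒IsParentStep {v} {s} p = ≡.subst (λ u → parent u ≡ just s) (sym (proj₁ (parent-just v s p))) p

  depth>0⇒parent : ∀ v → 0 < depth v → ∃[ s ] parent v ≡ just s × tailOf S s ≡ v × suc (depth (headOf S s)) ≡ depth v
  depth>0⇒parent v 0<d with parent v in p
  ... | just s  = s , refl , parent-just v s p
  ... | nothing = ⊥-elim (<-irrefl (sym (parent-nothing v p)) 0<d)

  ParentWalk-depth-≤ : ∀ {u w} ss → IsWalk S u ss w → ParentWalk ss → depth w ≤ depth u
  ParentWalk-depth-≤ []       refl        []       = ≤-refl
  ParentWalk-depth-≤ (s ∷ ss) (refl , p) (q ∷ qs) =
    ≤-trans (ParentWalk-depth-≤ ss p qs) (≤-trans (ℕ.n≤1+n _) (≤-reflexive (parentStep-depth s q)))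

  ParentWalk-tails : ∀ {u w} ss → IsWalk S u ss w → ParentWalk ss → ∀ {v} → v ∈ tails ss → depth w < depth v × depth v ≤ depth u
  ParentWalk-tails (s ∷ ss) (refl , p) (q ∷ qs) (here refl) =
    ≤-trans (s≤s (ParentWalk-depth-≤ ss p qs)) (≤-reflexive (parentStep-depth s q)) , ≤-refl
  ParentWalk-tails (s ∷ ss) (refl , p) (q ∷ qs) (there v∈) with ParentWalk-tails ss p qs v∈
  ... | w<v , v≤h = w<v , ≤-trans v≤h (≤-trans (ℕ.n≤1+n _) (≤-reflexive (parentStep-depth s q)))

  ParentWalk-heads : ∀ {u w} ss → IsWalk S u ss w → ParentWalk ss → ∀ {v} → v ∈ heads ss → depth v < depth u
  ParentWalk-heads (s ∷ ss) (refl , p) (q ∷ qs) (here refl) = ≤-reflexive (parentStep-depth s q)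
  ParentWalk-heads (s ∷ ss) (refl , p) (q ∷ qs) (there v∈) =
    ≤-trans (ParentWalk-heads ss p qs v∈) (≤-trans (ℕ.n≤1+n _) (≤-reflexive (parentStep-depth s q)))

  ParentWalk-unique : ∀ {u w} ss → IsWalk S u ss w → ParentWalk ss → Unique (tails ss)
  ParentWalk-unique []       _          _        = []
  ParentWalk-unique (s ∷ ss) (refl , p) (q ∷ qs) =
    All.tabulate (λ v∈ t≡v → <-irrefl refl (≤-trans (≤-reflexive (parentStep-depth s q))
      (≤-trans (≤-reflexive (cong depth t≡v)) (proj₂ (ParentWalk-tails ss p qs v∈)))))
    ∷ ParentWalk-unique ss p qs

  private
    noTwoCycle : ∀ {a b} → suc a ≡ b → suc b ≡ a → ⊥
    noTwoCycle {a} refl 2+a≡a = <-irrefl (sym 2+a≡a) (ℕ.m<n⇒m<1+n (ℕ.n<1+n a))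

  parentStep-edge-injective : ∀ s s′ → IsParentStep s → IsParentStep s′ → proj₁ s ≡ proj₁ s′ → tailOf S s ≡ tailOf S s′
  parentStep-edge-injective (e , true)  (.e , true)  _ _ refl = refl
  parentStep-edge-injective (e , false) (.e , false) _ _ refl = refl
  parentStep-edge-injective (e , true)  (.e , false) p q refl = ⊥-elim (noTwoCycle (parentStep-depth _ p) (parentStep-depth _ q))
  parentStep-edge-injective (e , false) (.e , true)  p q refl = ⊥-elim (noTwoCycle (parentStep-depth _ p) (parentStep-depth _ q))

  ParentWalk-end : (P : V → Set) → (∀ s → IsParentStep s → P (headOf S s)) →
                   ∀ {u w} ss → IsWalk S u ss w → ParentWalk ss → P u → P w
  ParentWalk-end P step []       refl        []       Pu = Pu
  ParentWalk-end P step (s ∷ ss) (refl , p) (q ∷ qs) _  = ParentWalk-end P step ss p qs (step s q)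

  record CommonAncestry (x y : V) : Set where
    field
      L R        : List (Step S)
      p q        : V
      L-walk     : IsWalk S x L p
      R-walk     : IsWalk S y R q
      L-parents  : ParentWalk L
      R-parents  : ParentWalk R
      disjoint   : Disjoint (tails L) (tails R)
      ends       : p ≡ q ⊎ (p ≢ q × depth p ≡ 0 × depth q ≡ 0)

  CommonAncestry-reached : (P : V → Set) → (∀ s → IsParentStep s → P (headOf S s)) →
                           ∀ {x y} (r : CommonAncestry x y) → P x → P y → P (CommonAncestry.p r) × P (CommonAncestry.q r)
  CommonAncestry-reached P step r Px Py = ParentWalk-end P step L L-walk L-parents Px , ParentWalk-end P step R R-walk R-parents Py
    where open CommonAncestry r

  ParentWalk-∉-deeper : ∀ {u w} ss → IsWalk S u ss w → ParentWalk ss → ∀ {v} → depth u < depth v → v ∉ tails ss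
  ParentWalk-∉-deeper ss walk up u<v v∈ = <-irrefl refl (≤-trans u<v (proj₂ (ParentWalk-tails ss walk up v∈)))

  module _ {x y : V} where
    open CommonAncestry

    swapAncestry : CommonAncestry x y → CommonAncestry y x
    swapAncestry r = record
      { L = R r ; R = L r ; p = q r ; q = p r ; L-walk = R-walk r ; R-walk = L-walk r
      ; L-parents = R-parents r ; R-parents = L-parents r ; disjoint = λ (v∈R , v∈L) → disjoint r (v∈L , v∈R)
      ; ends = Data.Sum.map sym (λ (p≢q , p≡0 , q≡0) → p≢q ∘ sym , q≡0 , p≡0) (ends r)
      }

  extendLeft : ∀ {x y} s → IsParentStep s → tailOf S s ≡ x → (r : CommonAncestry (headOf S s) y) →
               x ∉ tails (CommonAncestry.R r) → CommonAncestry x y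
  extendLeft s up t≡x r x∉R = record
    { L = s ∷ L ; R = R ; p = p ; q = q ; L-walk = t≡x , L-walk ; R-walk = R-walk ; L-parents = up ∷ L-parents
    ; R-parents = R-parents ; disjoint = disjoint′ ; ends = ends }
    where
    open CommonAncestry r
    disjoint′ : Disjoint (tails (s ∷ L)) (tails R)
    disjoint′ (here refl , v∈R) = x∉R (≡.subst (_∈ tails R) t≡x v∈R)
    disjoint′ (there v∈L , v∈R) = disjoint (v∈L , v∈R)

  extendRight : ∀ {x y} s → IsParentStep s → tailOf S s ≡ y → (r : CommonAncestry x (headOf S s)) →
                y ∉ tails (CommonAncestry.L r) → CommonAncestry x y
  extendRight s up t≡y r y∉L = swapAncestry (extendLeft s up t≡y (swapAncestry r) y∉L)

  private
    meetHere : ∀ {x y} → x ≡ y ⊎ (x ≢ y × depth x ≡ 0 × depth y ≡ 0) → CommonAncestry x y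
    meetHere ends = record { L = [] ; R = [] ; p = _ ; q = _ ; L-walk = refl ; R-walk = refl ; L-parents = [] ; R-parents = []
                           ; disjoint = λ () ; ends = ends }

  commonAncestry : ∀ x y → CommonAncestry x y
  commonAncestry x y = go (suc (depth x + depth y)) x y ≤-refl
    where
    go : ∀ fuel x y → depth x + depth y < fuel → CommonAncestry x y
    go (suc fuel) x y bound with x ≟ y
    ... | yes x≡y = meetHere (inj₁ x≡y)
    ... | no x≢y with ℕ.<-cmp (depth x) (depth y)
    ...   | tri< dx<dy _ _ with depth>0⇒parent y (ℕ.<-≤-trans (s≤s z≤n) dx<dy)
    ...     | t , pt , t≡y , dt = extendRight t (parent⇒IsParentStep pt) t≡y r
                (ParentWalk-∉-deeper _ (CommonAncestry.L-walk r) (CommonAncestry.L-parents r) dx<dy)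
      where
      r : CommonAncestry x (headOf S t)
      r = go fuel x (headOf S t) (ℕ.≤-pred (≤-trans (s≤s (≤-reflexive (trans (sym (ℕ.+-suc (depth x) _)) (cong (depth x +_) dt)))) bound))
    go (suc fuel) x y bound | no x≢y | tri> _ _ dy<dx with depth>0⇒parent x (ℕ.<-≤-trans (s≤s z≤n) dy<dx)
    ...     | s , ps , s≡x , ds = extendLeft s (parent⇒IsParentStep ps) s≡x r
                (ParentWalk-∉-deeper _ (CommonAncestry.R-walk r) (CommonAncestry.R-parents r) dy<dx)
      where
      r : CommonAncestry (headOf S s) y
      r = go fuel (headOf S s) y (ℕ.≤-pred (≤-trans (s≤s (≤-reflexive (cong (_+ depth y) ds))) bound))
    go (suc fuel) x y bound | no x≢y | tri≈ _ dx≡dy _ with depth x ℕ.≟ 0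
    ...     | yes dx≡0 = meetHere (inj₂ (x≢y , dx≡0 , trans (sym dx≡dy) dx≡0))
    ...     | no dx≢0 with depth>0⇒parent x (ℕ.n≢0⇒n>0 dx≢0) | depth>0⇒parent y (≡.subst (0 <_) dx≡dy (ℕ.n≢0⇒n>0 dx≢0))
    ...       | s , ps , s≡x , ds | t , pt , t≡y , dt =
      extendLeft s (parent⇒IsParentStep ps) s≡x (extendRight t (parent⇒IsParentStep pt) t≡y r y∉L) x∉R
      where
      r : CommonAncestry (headOf S s) (headOf S t)
      r = go fuel (headOf S s) (headOf S t) (≤-trans (s≤s (ℕ.+-monoʳ-≤ _ (ℕ.n≤1+n _))) (≤-trans (≤-reflexive (cong₂ _+_ ds dt)) (ℕ.≤-pred bound)))
      y∉L : y ∉ tails (CommonAncestry.L r)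
      y∉L = ParentWalk-∉-deeper _ (CommonAncestry.L-walk r) (CommonAncestry.L-parents r) (≤-trans (≤-reflexive ds) (≤-reflexive dx≡dy))
      x∉R : x ∉ tails (t ∷ CommonAncestry.R r)
      x∉R (here x≡t)  = x≢y (trans x≡t t≡y)
      x∉R (there x∈R) = ParentWalk-∉-deeper _ (CommonAncestry.R-walk r) (CommonAncestry.R-parents r)
                          (≤-trans (≤-reflexive dt) (≤-reflexive (sym dx≡dy))) x∈R

  record PathToRoot (u : V) : Set where
    field
      path   : List (Step S)
      root   : V
      walk   : IsWalk S u path root
      up     : ParentWalk path
      isRoot : depth root ≡ 0

  pathToRoot : ∀ u → PathToRoot u
  pathToRoot u = go (suc (depth u)) u ≤-refl
    where
    go : ∀ fuel u → depth u < fuel → PathToRoot u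
    go (suc fuel) u bound with depth u ℕ.≟ 0
    ... | yes du≡0 = record { path = [] ; root = u ; walk = refl ; up = [] ; isRoot = du≡0 }
    ... | no du≢0 with depth>0⇒parent u (ℕ.n≢0⇒n>0 du≢0)
    ...   | s , ps , s≡u , ds = record { path = s ∷ path ; root = root ; walk = s≡u , walk ; up = parent⇒IsParentStep ps ∷ up
                                       ; isRoot = isRoot }
      where open PathToRoot (go fuel (headOf S s) (ℕ.≤-pred (≤-trans (s≤s (≤-reflexive ds)) bound)))


  TreeEdge : Fin (nE S) → Set
  TreeEdge e = ∃[ b ] IsParentStep (e , b)

  treeEdge? : ∀ e → Dec (TreeEdge e)
  treeEdge? e with parent (end S e false) ≟ₘ just (e , false) | parent (end S e true) ≟ₘ just (e , true)
    where
    _≟ₘ_ : DecidableEquality (Maybe (Step S))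
    _≟ₘ_ = Data.Maybe.Properties.≡-dec (Data.Product.Properties.≡-dec _≟_ Data.Bool.Properties._≟_)
  ... | yes p | _     = yes (false , p)
  ... | no _  | yes q = yes (true , q)
  ... | no ¬p | no ¬q = no λ { (false , p) → ¬p p ; (true , q) → ¬q q }

  nonTree∉ParentWalk : ∀ {e} → ¬ TreeEdge e → ∀ {ss} → ParentWalk ss → e ∉ edgesOf S ss
  nonTree∉ParentWalk ¬tree up e∈ with ∈-map⁻ proj₁ e∈
  ... | (e , b) , s∈ , refl = ¬tree (b , All.lookup up s∈)

  ParentWalk-uniqueEdges : ∀ {ss} → ParentWalk ss → Unique (tails ss) → Unique (edgesOf S ss)
  ParentWalk-uniqueEdges []       _              = []
  ParentWalk-uniqueEdges (p ∷ up) (t∉ ∷ unique) = All.tabulate distinct ∷ ParentWalk-uniqueEdges up unique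
    where
    distinct : ∀ {e} → e ∈ edgesOf S _ → _ ≢ e
    distinct e∈ e≡ with ∈-map⁻ proj₁ e∈
    ... | s′ , s′∈ , refl = All.lookup t∉ (∈-map⁺ (tailOf S) s′∈)
                              (parentStep-edge-injective _ s′ p (All.lookup up s′∈) e≡)

  ParentWalks-disjointEdges : ∀ {ss ts} → ParentWalk ss → ParentWalk ts → Disjoint (tails ss) (tails ts) →
                              Disjoint (edgesOf S ss) (edgesOf S ts)
  ParentWalks-disjointEdges upₛ upₜ disjoint (e∈ss , e∈ts) with ∈-map⁻ proj₁ e∈ss | ∈-map⁻ proj₁ e∈ts
  ... | s , s∈ , refl | t , t∈ , e≡ = disjoint (∈-map⁺ (tailOf S) s∈ ,
    ≡.subst (_∈ tails _) (sym (parentStep-edge-injective s t (All.lookup upₛ s∈) (All.lookup upₜ t∈) e≡)) (∈-map⁺ (tailOf S) t∈))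

  closeUp-uniqueTails : ∀ {x y p q} L R M d → IsWalk S x L p → IsWalk S y R q → ParentWalk L → ParentWalk R →
                        Disjoint (tails L) (tails R) → d ≡ depth p → d ≡ depth q →
                        Unique M → (∀ {v} → v ∈ M → depth v ≤ d) → Unique (tails L ++ M ++ tails R)
  closeUp-uniqueTails L R M d wL wR upL upR disjoint d≡p d≡q uniqueM shallow =
    Unique.++⁺ (ParentWalk-unique L wL upL) (Unique.++⁺ uniqueM (ParentWalk-unique R wR upR) disjointMR) disjointL
    where
    deepL : ∀ {v} → v ∈ tails L → d < depth v
    deepL v∈ = ≡.subst (_< _) (sym d≡p) (proj₁ (ParentWalk-tails L wL upL v∈))
    deepR : ∀ {v} → v ∈ tails R → d < depth v
    deepR v∈ = ≡.subst (_< _) (sym d≡q) (proj₁ (ParentWalk-tails R wR upR v∈))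
    disjointMR : Disjoint M (tails R)
    disjointMR (v∈M , v∈R) = <-irrefl refl (≤-trans (deepR v∈R) (shallow v∈M))
    disjointL : Disjoint (tails L) (M ++ tails R)
    disjointL (v∈L , v∈MR) with ∈-++⁻ M v∈MR
    ... | inj₁ v∈M = <-irrefl refl (≤-trans (deepL v∈L) (shallow v∈M))
    ... | inj₂ v∈R = disjoint (v∈L , v∈R)

  closeUp-uniqueEdges : ∀ {x y p q e} L R es → IsWalk S x L p → IsWalk S y R q → ParentWalk L → ParentWalk R →
                        Disjoint (tails L) (tails R) → ¬ TreeEdge e → Unique es → e ∉ es →
                        (∀ {e′} → e′ ∈ es → ¬ TreeEdge e′) → Unique (edgesOf S L ++ es ++ e ∷ edgesOf S R)
  closeUp-uniqueEdges {e = e} L R es wL wR upL upR disjoint ¬tree uniqueEs e∉es nonTreeEs =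
    Unique.++⁺ (ParentWalk-uniqueEdges upL (ParentWalk-unique L wL upL))
      (Unique.++⁺ uniqueEs uniqueER disjointEsR) disjointL
    where
    uniqueER : Unique (e ∷ edgesOf S R)
    uniqueER = All.tabulate (λ e′∈ e≡e′ → nonTree∉ParentWalk ¬tree upR (≡.subst (_∈ _) (sym e≡e′) e′∈))
             ∷ ParentWalk-uniqueEdges upR (ParentWalk-unique R wR upR)
    notInWalk : ∀ {e′ ss} → e′ ∈ es → ParentWalk ss → e′ ∉ edgesOf S ss
    notInWalk e′∈ = nonTree∉ParentWalk (nonTreeEs e′∈)
    disjointEsR : Disjoint es (e ∷ edgesOf S R)
    disjointEsR (e′∈ , here refl)  = e∉es e′∈
    disjointEsR (e′∈ , there e′∈R) = notInWalk e′∈ upR e′∈R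
    disjointL : Disjoint (edgesOf S L) (es ++ e ∷ edgesOf S R)
    disjointL (e′∈L , e′∈) with ∈-++⁻ es e′∈
    ... | inj₁ e′∈es          = notInWalk e′∈es upL e′∈L
    ... | inj₂ (here refl)    = nonTree∉ParentWalk ¬tree upL e′∈L
    ... | inj₂ (there e′∈R)   = ParentWalks-disjointEdges upL upR disjoint (e′∈L , e′∈R)

  ancestry : ∀ e → CommonAncestry (end S e false) (end S e true)
  ancestry e = commonAncestry (end S e false) (end S e true)

  fundamentalCycle : ∀ e → ¬ TreeEdge e → CommonAncestry.p (ancestry e) ≡ CommonAncestry.q (ancestry e) → Cycle S
  fundamentalCycle e ¬tree p≡q = closeUp-cycle L [] R (e , true) L-walk p≡q R-walk refl refl
    (closeUp-uniqueTails L R [ q ] (depth q) L-walk R-walk L-parents R-parents disjoint (cong depth (sym p≡q)) refl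
      ([] ∷ []) λ { (here refl) → ≤-refl })
    (closeUp-uniqueEdges L R [] L-walk R-walk L-parents R-parents disjoint ¬tree [] (λ ()) (λ ()))
    where open CommonAncestry (ancestry e)

module ForestPotential {c ℓ} (G : AbelianGroup c ℓ) (S : SignedGraph) (ω : Orientation S) (compatible : Compatible S ω)
                       (f : Fin (nE S) → AbelianGroup.Carrier G) (F : RootedForest S)
                       (g₀ : Fin (nV S) → AbelianGroup.Carrier G) where
  open AbelianGroup G
  open Walks S
  open ClosedWalks S
  open Coboundary G S ω
  open Tension G S ω compatible
  open RootedForest F
  open ForestWalks F

  potentialAt : ℕ → V → Carrier
  potentialAt zero    v = g₀ v
  potentialAt (suc k) v with parent v
  ... | just (e , b) = act G (ω e b) (f e) ∙ act G (sign S e) (potentialAt k (end S e (not b)))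
  ... | nothing      = g₀ v

  potential : V → Carrier
  potential v = potentialAt (depth v) v

  potential-root : ∀ v → depth v ≡ 0 → potential v ≡ g₀ v
  potential-root v d≡0 = cong (λ k → potentialAt k v) d≡0

  parentStep-Matches : ∀ s → IsParentStep s → Matches potential f (proj₁ s)
  parentStep-Matches (e , b) p = Matches-fromEnd e b (reflexive (≡.trans
    (cong (λ k → potentialAt k (end S e b)) (≡.sym (parentStep-depth (e , b) p))) (unfold (depth (end S e (not b))))))
    where
    unfold : ∀ k → potentialAt (suc k) (end S e b) ≡ act G (ω e b) (f e) ∙ act G (sign S e) (potentialAt k (end S e (not b)))
    unfold k rewrite p = ≡.refl

  ParentWalk-Matches : ∀ {ss} → ParentWalk ss → All (λ s → Matches potential f (proj₁ s)) ss
  ParentWalk-Matches = All.map (parentStep-Matches _)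

  MatchesExcept : Fin (nE S) → Step S → Set ℓ
  MatchesExcept e s = proj₁ s ≡ e ⊎ Matches potential f (proj₁ s)

  closeUp-matchesExcept : ∀ e b L A R → ParentWalk L → ParentWalk R → All (λ s → Matches potential f (proj₁ s)) A →
                          All (MatchesExcept e) (closeUp L A R (e , b))
  closeUp-matchesExcept e b L A R upL upR matchesA = All.++⁺ (All.map inj₂ (ParentWalk-Matches upL))
    (All.++⁺ (All.map inj₂ matchesA) (All.++⁺ (All-reverseWalk R (All.map inj₂ (ParentWalk-Matches upR))) (inj₁ ≡.refl ∷ [])))

  closeUp-occ : ∀ e b L A R → ParentWalk L → ParentWalk R → ¬ TreeEdge e → e ∉ edgesOf S A → occ S e (closeUp L A R (e , b)) ≡ 1
  closeUp-occ e b L A R upL upR ¬tree e∉A = begin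
    occ S e (L ++ A ++ reverseWalk R ++ [ e , b ])
      ≡⟨ occ-++ e L _ ⟩
    occ S e L + occ S e (A ++ reverseWalk R ++ [ e , b ])
      ≡⟨ cong₂ _+_ (occ-∉ L (nonTree∉ParentWalk ¬tree upL)) (occ-++ e A _) ⟩
    occ S e A + occ S e (reverseWalk R ++ [ e , b ])
      ≡⟨ cong₂ _+_ (occ-∉ A e∉A) (occ-++ e (reverseWalk R) _) ⟩
    occ S e (reverseWalk R) + occ S e [ e , b ]
      ≡⟨ cong₂ _+_ (≡.trans (occ-reverseWalk e R) (occ-∉ R (nonTree∉ParentWalk ¬tree upR))) (occ-[ e ] {b}) ⟩
    1 ∎
    where open ≡.≡-Reasoning

  module _ (tension : IsTension G S ω f) where

    Matches-fromCircuitWalk : ∀ e (W : CircuitWalk S) → signProd S (cwSteps W) ≡ Sign.+ → occ S e (cwSteps W) ≡ 1 →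
                              All (MatchesExcept e) (cwSteps W) → Matches potential f e
    Matches-fromCircuitWalk e W balanced once others =
      Matches-fromBalancedWalk e (cwSteps W) (cwClosed W) balanced (tension W) once others

    Matches-fromBalancedCycle : ∀ e (C : Cycle S) → Balanced S C → occ S e (steps C) ≡ 1 → All (MatchesExcept e) (steps C) →
                                Matches potential f e
    Matches-fromBalancedCycle e C balanced =
      Matches-fromCircuitWalk e (mkCircuitWalk (start C) (steps C) (closed C) (balancedCycle C balanced) (λ _ → ≡.refl)) balanced

    balancedFundamentalCycle⇒Matches : ∀ e (¬tree : ¬ TreeEdge e) (p≡q : CommonAncestry.p (ancestry e) ≡ CommonAncestry.q (ancestry e)) →
                                       Balanced S (fundamentalCycle e ¬tree p≡q) →
                                       Matches potential f e
    balancedFundamentalCycle⇒Matches e ¬tree p≡q balanced = Matches-fromBalancedCycle e (fundamentalCycle e ¬tree p≡q) balanced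
      (closeUp-occ e true L [] R L-parents R-parents ¬tree (λ ()))
      (closeUp-matchesExcept e true L [] R L-parents R-parents [])
      where open CommonAncestry (ancestry e)

module BalancedComponent {c ℓ} (G : AbelianGroup c ℓ) (S : SignedGraph) (ω : Orientation S) (compatible : Compatible S ω)
                         (f : Fin (nE S) → AbelianGroup.Carrier G) (tension : IsTension G S ω f) (F : RootedForest S)
                         (Reached : Fin (nV S) → Set) where
  open AbelianGroup G using (ε)
  open Walks S using (V)
  open Coboundary G S ω using (Matches)
  open RootedForest F
  open ForestWalks F
  open ForestPotential G S ω compatible f F (λ _ → ε)

  module _ (Reached-parent : ∀ s → IsParentStep s → Reached (headOf S s))
           (uniqueRoot : ∀ {u v} → Reached u → Reached v → depth u ≡ 0 → depth v ≡ 0 → u ≡ v)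
           (fundamentalCycles-balanced : ∀ e → Reached (end S e false) → (¬tree : ¬ TreeEdge e) →
              (p≡q : CommonAncestry.p (ancestry e) ≡ CommonAncestry.q (ancestry e)) → Balanced S (fundamentalCycle e ¬tree p≡q))
           where

    balancedComponent-Matches : ∀ e → Reached (end S e false) → Reached (end S e true) → Matches potential f e
    balancedComponent-Matches e reached₁ reached₂ with treeEdge? e
    ... | yes (b , p) = parentStep-Matches (e , b) p
    ... | no ¬tree with CommonAncestry.ends (ancestry e)
    ...   | inj₁ p≡q = balancedFundamentalCycle⇒Matches tension e ¬tree p≡q (fundamentalCycles-balanced e reached₁ ¬tree p≡q)
    ...   | inj₂ (p≢q , p≡0 , q≡0) with CommonAncestry-reached Reached Reached-parent (ancestry e) reached₁ reached₂
    ...     | reachedP , reachedQ = ⊥-elim (p≢q (uniqueRoot reachedP reachedQ p≡0 q≡0))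

module UnbalancedComponent {c ℓ} (G : AbelianGroup c ℓ) (S : SignedGraph) (ω : Orientation S) (compatible : Compatible S ω)
                           (f : Fin (nE S) → AbelianGroup.Carrier G) (tension : IsTension G S ω f) (F : RootedForest S)
                           (U : Cycle S) (U-unbalanced : Unbalanced S U) (y₀ : AbelianGroup.Carrier G) where
  open AbelianGroup G using (_≈_; reflexive)
  open ≡ using (refl; sym; trans)
  open Walks S
  open ClosedWalks S
  open Coboundary G S ω
  open Tension G S ω compatible
  open CycleValues G S ω compatible f using (assignAlong)
  open RootedForest F
  open ForestWalks F
  open ForestPotential G S ω compatible f F (assignAlong y₀ (steps U))

  private
    us : List (Step S)
    us = steps U

  module _ (U-matches : All (λ s → Matches (assignAlong y₀ us) f (proj₁ s)) us)
           (Reached : V → Set) (Reached-parent : ∀ s → IsParentStep s → Reached (headOf S s))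
           (onU⇒root : ∀ {v} → v ∈ tails us → depth v ≡ 0)
           (root⇒onU : ∀ {v} → Reached v → depth v ≡ 0 → v ∈ tails us) where

    U-nonTree : ∀ {e} → e ∈ edgesOf S us → ¬ TreeEdge e
    U-nonTree e∈ (b , p) with ∈-map⁻ proj₁ e∈
    ... | s , s∈ , refl = ℕ.1+n≢0 (trans (parentStep-depth _ p) (onU⇒root (closedWalk-ends us (closed U) (nonempty U) s∈ b)))

    deeper∉U : ∀ {w u} → depth w < depth u → u ∉ tails us
    deeper∉U w<u u∈U = ℕ.n≮0 (ℕ.<-≤-trans w<u (≤-reflexive (onU⇒root u∈U)))

    U-Matches : All (λ s → Matches potential f (proj₁ s)) us
    U-Matches = All.tabulate λ {s} s∈ → Matches-cong (proj₁ s) (onRoot s∈ true) (onRoot s∈ false) (All.lookup U-matches s∈)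
      where
      onRoot : ∀ {s} → s ∈ us → ∀ b → assignAlong y₀ us (end S (proj₁ s) b) ≈ potential (end S (proj₁ s) b)
      onRoot s∈ b = reflexive (sym (potential-root _ (onU⇒root (closedWalk-ends us (closed U) (nonempty U) s∈ b))))

    U-edge-Matches : ∀ {e} → e ∈ edgesOf S us → Matches potential f e
    U-edge-Matches e∈ with ∈-map⁻ proj₁ e∈
    ... | s , s∈ , refl = All.lookup U-Matches s∈

    module Fundamental (e : Fin (nE S)) (¬tree : ¬ TreeEdge e) (e∉U : e ∉ edgesOf S us)
                       (p≡q : CommonAncestry.p (ancestry e) ≡ CommonAncestry.q (ancestry e)) where
      open CommonAncestry (ancestry e) public

      C : Cycle S
      C = fundamentalCycle e ¬tree p≡q

      C-tails : ∀ {u} → u ∈ tails (steps C) → u ∈ tails L ⊎ u ≡ q ⊎ u ∈ tails R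
      C-tails u∈ with ∈-++⁻ (tails L) (∈-resp-↭ (tails-closeUp L [] R (e , true) R-walk refl) u∈)
      ... | inj₁ u∈L         = inj₁ u∈L
      ... | inj₂ (here u≡q)  = inj₂ (inj₁ u≡q)
      ... | inj₂ (there u∈R) = inj₂ (inj₂ u∈R)

      q∈C : q ∈ tails (steps C)
      q∈C = ∈-resp-↭ (↭-sym (tails-closeUp L [] R (e , true) R-walk refl)) (∈-++⁺ʳ (tails L) (here refl))

      C-depth : ∀ {u} → u ∈ tails (steps C) → depth q ≤ depth u
      C-depth u∈ with C-tails u∈
      ... | inj₁ u∈L         = ≤-trans (≤-reflexive (cong depth (sym p≡q))) (ℕ.<⇒≤ (proj₁ (ParentWalk-tails L L-walk L-parents u∈L)))
      ... | inj₂ (inj₁ refl) = ≤-refl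
      ... | inj₂ (inj₂ u∈R)  = ℕ.<⇒≤ (proj₁ (ParentWalk-tails R R-walk R-parents u∈R))

      C-edges∉U : ∀ e′ → e′ ∈ cycEdges S C → e′ ∉ cycEdges S U
      C-edges∉U e′ e′∈C e′∈U with ∈-++⁻ (edgesOf S L) (∈-resp-↭ (edgesOf-closeUp L [] R (e , true)) e′∈C)
      ... | inj₁ e′∈L         = nonTree∉ParentWalk (U-nonTree e′∈U) L-parents e′∈L
      ... | inj₂ (here refl)  = e∉U e′∈U
      ... | inj₂ (there e′∈R) = nonTree∉ParentWalk (U-nonTree e′∈U) R-parents e′∈R

      C-matchesExcept : All (MatchesExcept e) (steps C)
      C-matchesExcept = closeUp-matchesExcept e true L [] R L-parents R-parents []

      C-occ : occ S e (steps C) ≡ 1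
      C-occ = closeUp-occ e true L [] R L-parents R-parents ¬tree (λ ())

      module C↻ = Rotation (rotate (steps C) (closed C) q∈C)

    tightHandcuff-Matches : ∀ e ¬tree e∉U p≡q → Unbalanced S (Fundamental.C e ¬tree e∉U p≡q) →
                            Reached (CommonAncestry.q (ancestry e)) → depth (CommonAncestry.q (ancestry e)) ≡ 0 → Matches potential f e
    tightHandcuff-Matches e ¬tree e∉U p≡q C-unbalanced reached q≡0 = Matches-fromCircuitWalk tension e W balanced once others
      where
      open Fundamental e ¬tree e∉U p≡q
      q∈U : q ∈ tails us
      q∈U = root⇒onU reached q≡0
      module U↻ = Rotation (rotate us (closed U) q∈U)
      common : ∀ u → u ∈ cycVerts S C → u ∈ cycVerts S U → u ≡ q
      common u u∈C u∈U with C-tails u∈C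
      ... | inj₁ u∈L         = ⊥-elim (deeper∉U (proj₁ (ParentWalk-tails L L-walk L-parents u∈L)) u∈U)
      ... | inj₂ (inj₁ u≡q)  = u≡q
      ... | inj₂ (inj₂ u∈R)  = ⊥-elim (deeper∉U (proj₁ (ParentWalk-tails R R-walk R-parents u∈R)) u∈U)
      W : CircuitWalk S
      W = mkCircuitWalk q (C↻.rotated ++ U↻.rotated) (IsWalk-++ C↻.rotated C↻.walk U↻.walk)
            (tightHandcuff C U C-unbalanced U-unbalanced C-edges∉U q q∈C q∈U common)
            (λ e′ → trans (occ-++ e′ C↻.rotated _) (cong₂ _+_ (occ-↭ e′ C↻.↭ss) (occ-↭ e′ U↻.↭ss)))
      balanced : signProd S (C↻.rotated ++ U↻.rotated) ≡ Sign.+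
      balanced = trans (signProd-++ C↻.rotated _) (cong₂ _·_ (trans (signProd-↭ C↻.↭ss) (unbalanced⇒- C C-unbalanced))
                                                             (trans (signProd-↭ U↻.↭ss) (unbalanced⇒- U U-unbalanced)))
      once : occ S e (C↻.rotated ++ U↻.rotated) ≡ 1
      once = trans (occ-++ e C↻.rotated _) (cong₂ _+_ (trans (occ-↭ e C↻.↭ss) C-occ) (trans (occ-↭ e U↻.↭ss) (occ-∉ us e∉U)))
      others : All (MatchesExcept e) (C↻.rotated ++ U↻.rotated)
      others = All.++⁺ (All-resp-↭ (↭-sym C↻.↭ss) C-matchesExcept) (All-resp-↭ (↭-sym U↻.↭ss) (All.map inj₂ U-Matches))

    looseHandcuff-Matches : ∀ e ¬tree e∉U p≡q → Unbalanced S (Fundamental.C e ¬tree e∉U p≡q) →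
                            Reached (CommonAncestry.q (ancestry e)) → depth (CommonAncestry.q (ancestry e)) ≢ 0 → Matches potential f e
    looseHandcuff-Matches e ¬tree e∉U p≡q C-unbalanced reached q≢0 = Matches-fromCircuitWalk tension e W balanced once others
      where
      open Fundamental e ¬tree e∉U p≡q
      open PathToRoot (pathToRoot q) renaming (path to P; walk to P-walk; up to P-parents)
      root∈U : root ∈ tails us
      root∈U = root⇒onU (ParentWalk-end Reached Reached-parent P P-walk P-parents reached) isRoot
      module U↻ = Rotation (rotate us (closed U) root∈U)
      steps′ : List (Step S)
      steps′ = C↻.rotated ++ P ++ U↻.rotated ++ reverseWalk P
      pathVerts≡ : q ∷ heads P ≡ tails P ++ [ root ]
      pathVerts≡ = sym (tails-∷ʳ P P-walk)
      path : Path S q root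
      path = mkPath P P-walk (≡.subst Unique (sym pathVerts≡) (Unique.++⁺ (ParentWalk-unique P P-walk P-parents) ([] ∷ [])
               λ { (v∈P , here refl) → <-irrefl refl (proj₁ (ParentWalk-tails P P-walk P-parents v∈P)) }))
      C∩U : ∀ u → u ∈ cycVerts S C → u ∉ cycVerts S U
      C∩U u u∈C u∈U = q≢0 (ℕ.n≤0⇒n≡0 (≤-trans (C-depth u∈C) (≤-reflexive (onU⇒root u∈U))))
      P∩C : ∀ u → u ∈ pathVerts S path → u ∈ cycVerts S C → u ≡ q
      P∩C u (here u≡q)   _   = u≡q
      P∩C u (there u∈hP) u∈C = ⊥-elim (<-irrefl refl (ℕ.<-≤-trans (ParentWalk-heads P P-walk P-parents u∈hP) (C-depth u∈C)))
      P∩U : ∀ u → u ∈ pathVerts S path → u ∈ cycVerts S U → u ≡ root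
      P∩U u u∈P u∈U with ∈-++⁻ (tails P) (≡.subst (u ∈_) pathVerts≡ u∈P)
      ... | inj₁ u∈tP          = ⊥-elim (deeper∉U (proj₁ (ParentWalk-tails P P-walk P-parents u∈tP)) u∈U)
      ... | inj₂ (here u≡root) = u≡root
      multiplicity : ∀ e′ → occ S e′ steps′ ≡ occ S e′ (steps C) + occ S e′ us + 2 * occ S e′ P
      multiplicity e′ = trans (occ-handcuff e′ C↻.rotated P U↻.rotated)
        (cong₂ (λ c u → c + u + 2 * occ S e′ P) (occ-↭ e′ C↻.↭ss) (occ-↭ e′ U↻.↭ss))
      W : CircuitWalk S
      W = mkCircuitWalk q steps′
            (IsWalk-++ C↻.rotated C↻.walk (IsWalk-++ P P-walk (IsWalk-++ U↻.rotated U↻.walk (IsWalk-reverse P P-walk))))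
            (looseHandcuff C U C-unbalanced U-unbalanced C∩U q root q∈C root∈U path P∩C P∩U) multiplicity
      balanced : signProd S steps′ ≡ Sign.+
      balanced = trans (signProd-handcuff C↻.rotated P U↻.rotated)
        (cong₂ _·_ (trans (signProd-↭ C↻.↭ss) (unbalanced⇒- C C-unbalanced)) (trans (signProd-↭ U↻.↭ss) (unbalanced⇒- U U-unbalanced)))
      P∌e : e ∉ edgesOf S P
      P∌e = nonTree∉ParentWalk ¬tree P-parents
      once : occ S e steps′ ≡ 1
      once = trans (multiplicity e) (cong₂ (λ c r → c + r) (cong₂ _+_ C-occ (occ-∉ us e∉U)) (cong (2 *_) (occ-∉ P P∌e)))
      others : All (MatchesExcept e) steps′
      others = All.++⁺ (All-resp-↭ (↭-sym C↻.↭ss) C-matchesExcept) (All.++⁺ (All.map inj₂ (ParentWalk-Matches P-parents))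
                 (All.++⁺ (All-resp-↭ (↭-sym U↻.↭ss) (All.map inj₂ U-Matches)) (All-reverseWalk P (All.map inj₂ (ParentWalk-Matches P-parents)))))

    module ArcCycle (e : Fin (nE S)) (¬tree : ¬ TreeEdge e) (e∉U : e ∉ edgesOf S us) (b : Bool) {p q : V}
                    (L A R : List (Step S)) (L-walk : IsWalk S (end S e (not b)) L p) (A-walk : IsWalk S p A q)
                    (R-walk : IsWalk S (end S e b) R q) (L-parents : ParentWalk L) (R-parents : ParentWalk R)
                    (disjoint : Disjoint (tails L) (tails R)) (p≡0 : depth p ≡ 0) (q≡0 : depth q ≡ 0)
                    (uniqueA : Unique (tails A ++ [ q ])) (A⊆U : ∀ {v} → v ∈ tails A → v ∈ tails us)
                    (uniqueEA : Unique (edgesOf S A)) (EA⊆U : ∀ {e′} → e′ ∈ edgesOf S A → e′ ∈ edgesOf S us)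
                    (A-matches : All (λ s → Matches potential f (proj₁ s)) A) where
      Z : Cycle S
      Z = closeUp-cycle L A R (e , b) L-walk A-walk R-walk refl refl
            (≡.subst (λ vs → Unique (tails L ++ vs)) (++-assoc (tails A) [ q ] (tails R))
               (closeUp-uniqueTails L R (tails A ++ [ q ]) 0 L-walk R-walk L-parents R-parents disjoint (sym p≡0) (sym q≡0) uniqueA shallow))
            (closeUp-uniqueEdges L R (edgesOf S A) L-walk R-walk L-parents R-parents disjoint ¬tree uniqueEA (e∉U ∘ EA⊆U) (U-nonTree ∘ EA⊆U))
        where
        shallow : ∀ {v} → v ∈ tails A ++ [ q ] → depth v ≤ 0
        shallow v∈ with ∈-++⁻ (tails A) v∈
        ... | inj₁ v∈A         = ≤-reflexive (onU⇒root (A⊆U v∈A))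
        ... | inj₂ (here refl) = ≤-reflexive q≡0

      balanced⇒Matches : Balanced S Z → Matches potential f e
      balanced⇒Matches balanced = Matches-fromBalancedCycle tension e Z balanced
        (closeUp-occ e b L A R L-parents R-parents ¬tree (e∉U ∘ EA⊆U)) (closeUp-matchesExcept e b L A R L-parents R-parents A-matches)

    arcs-Matches : ∀ e → ¬ TreeEdge e → e ∉ edgesOf S us → (let open CommonAncestry (ancestry e) in
                   p ≢ q → depth p ≡ 0 → depth q ≡ 0 → Reached p → Reached q → Matches potential f e)
    arcs-Matches e ¬tree e∉U p≢q p≡0 q≡0 reachedP reachedQ =
      Data.Sum.[ Z₁.balanced⇒Matches , Z₂.balanced⇒Matches ] (oneBalanced (signProd S (steps Z₁.Z)) _ signs)
      where
      open CommonAncestry (ancestry e)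
      α : Arcs U p q
      α = arcs U (root⇒onU reachedP p≡0) (root⇒onU reachedQ q≡0) p≢q
      open Arcs α
      open ArcsProperties α
      AB-matches : All (λ s → Matches potential f (proj₁ s)) A × All (λ s → Matches potential f (proj₁ s)) B
      AB-matches = All.++⁻ A (All-resp-↭ (↭-sym ↭X) U-Matches)
      disjointRL : Disjoint (tails R) (tails L)
      disjointRL (v∈R , v∈L) = disjoint (v∈L , v∈R)

      module Z₁ = ArcCycle e ¬tree e∉U true L A R L-walk A-walk R-walk L-parents R-parents disjoint p≡0 q≡0 uniqueTails-A∷q
        (tails⊆ ∘ ∈-++⁺ˡ) (proj₁ (Unique-++⁻ (edgesOf S A) uniqueEdges)) (edges⊆ ∘ ∈-++⁺ˡ) (proj₁ AB-matches)
      module Z₂ = ArcCycle e ¬tree e∉U false R B L R-walk B-walk L-walk R-parents L-parents disjointRL q≡0 p≡0 uniqueTails-B∷p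
        (tails⊆ ∘ ∈-++⁺ʳ (tails A)) (proj₁ (proj₂ (Unique-++⁻ (edgesOf S A) uniqueEdges))) (edges⊆ ∘ ∈-++⁺ʳ (edgesOf S A))
        (proj₂ AB-matches)

      signs : signProd S (steps Z₁.Z) · signProd S (steps Z₂.Z) ≡ Sign.-
      signs = trans (signProd-closeUp-pair L A R B e) (trans signProd-AB (unbalanced⇒- U U-unbalanced))

      oneBalanced : ∀ σ₁ σ₂ → σ₁ · σ₂ ≡ Sign.- → σ₁ ≡ Sign.+ ⊎ σ₂ ≡ Sign.+
      oneBalanced Sign.+ _      _ = inj₁ refl
      oneBalanced Sign.- Sign.+ _ = inj₂ refl
      oneBalanced Sign.- Sign.- ()

    unbalancedComponent-Matches : ∀ e → Reached (end S e false) → Reached (end S e true) → Matches potential f e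
    unbalancedComponent-Matches e reached₁ reached₂ with treeEdge? e
    ... | yes (b , p) = parentStep-Matches (e , b) p
    ... | no ¬tree with Data.List.Membership.DecPropositional._∈?_ _≟_ e (edgesOf S us)
    ...   | yes e∈U = U-edge-Matches e∈U
    ...   | no e∉U with CommonAncestry.ends (ancestry e) | CommonAncestry-reached Reached Reached-parent (ancestry e) reached₁ reached₂
    ...     | inj₂ (p≢q , p≡0 , q≡0) | reachedP , reachedQ = arcs-Matches e ¬tree e∉U p≢q p≡0 q≡0 reachedP reachedQ
    ...     | inj₁ p≡q               | _ , reachedQ with signProd S (steps (fundamentalCycle e ¬tree p≡q)) Sign.≟ Sign.+
    ...       | yes balanced = balancedFundamentalCycle⇒Matches tension e ¬tree p≡q balanced
    ...       | no unbalanced with depth (CommonAncestry.q (ancestry e)) ℕ.≟ 0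
    ...         | yes q≡0 = tightHandcuff-Matches e ¬tree e∉U p≡q unbalanced reachedQ q≡0
    ...         | no q≢0  = looseHandcuff-Matches e ¬tree e∉U p≡q unbalanced reachedQ q≢0

module ComponentPotential {c ℓ} (G : AbelianGroup c ℓ) (S : SignedGraph) (ω : Orientation S) (compatible : Compatible S ω)
                          (f : Fin (nE S) → AbelianGroup.Carrier G) (tension : IsTension G S ω f)
                          (condition : UnbalancedCycleCondition G S ω f) (r : Fin (nV S)) where
  open AbelianGroup G using (Carrier; ε)
  open ≡ using (refl; sym; trans)
  open Walks S
  open ClosedWalks S
  open Coboundary G S ω using (Matches)
  open CycleValues G S ω compatible f using (assignAlong; unbalancedCycle-values)
  open Components S
  open Reachability S using (module Closure)
  module Tree = From r
  open ForestWalks Tree.forest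

  record Result : Set (c ⊔ ℓ) where
    field
      potential : V → Carrier
      matches   : ∀ e → Connected r (end S e false) → Matches potential f e

  UnbalancedFundamental : Fin (nE S) → Set
  UnbalancedFundamental e = Connected r (end S e false) × ¬ TreeEdge e × p ≡ q ×
                            signProd S (closeUp L [] R (e , true)) ≡ Sign.-
    where open CommonAncestry (ancestry e)

  unbalancedFundamental? : ∀ e → Dec (UnbalancedFundamental e)
  unbalancedFundamental? e = connected? r (end S e false) ×-dec ¬? (treeEdge? e) ×-dec p Fin.≟ q
                             ×-dec signProd S (closeUp L [] R (e , true)) Sign.≟ Sign.-
    where open CommonAncestry (ancestry e)

  connected-end : ∀ {e} → Connected r (end S e false) → Connected r (end S e true)
  connected-end {e} r~e = Connected-trans r~e (Connected-step (e , false))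

  balancedComponent : (∀ e → ¬ UnbalancedFundamental e) → Result
  balancedComponent allBalanced = record
    { potential = ForestPotential.potential G S ω compatible f Tree.forest (λ _ → ε)
    ; matches   = λ e r~e → balancedComponent-Matches Tree.parent-Reached uniqueRoot balanced e r~e (connected-end r~e) }
    where
    open BalancedComponent G S ω compatible f tension Tree.forest (Connected r)
    isRoot : ∀ {v} → Connected r v → Tree.depth v ≡ 0 → v ≡ r
    isRoot {v} r~v d≡0 = isVertex⇒≡ r v (Tree.depth≡0⇒root v r~v d≡0)
    uniqueRoot : ∀ {u v} → Connected r u → Connected r v → Tree.depth u ≡ 0 → Tree.depth v ≡ 0 → u ≡ v
    uniqueRoot r~u r~v du≡0 dv≡0 = trans (isRoot r~u du≡0) (sym (isRoot r~v dv≡0))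
    balanced : ∀ e → Connected r (end S e false) → (¬tree : ¬ TreeEdge e) →
               (p≡q : CommonAncestry.p (ancestry e) ≡ CommonAncestry.q (ancestry e)) → Balanced S (fundamentalCycle e ¬tree p≡q)
    balanced e r~e ¬tree p≡q = notUnbalanced _ λ negative → allBalanced e (r~e , ¬tree , p≡q , negative)
      where
      notUnbalanced : ∀ σ → σ ≢ Sign.- → σ ≡ Sign.+
      notUnbalanced Sign.+ _   = refl
      notUnbalanced Sign.- σ≢- = ⊥-elim (σ≢- refl)

  unbalancedComponent : ∀ e₀ → UnbalancedFundamental e₀ → Result
  unbalancedComponent e₀ (r~e₀ , ¬tree , p≡q , negative) = record
    { potential = ForestPotential.potential G S ω compatible f OnU.forest (assignAlong y₀ (steps U))
    ; matches   = λ e r~e → unbalancedComponent-Matches (proj₂ values) OnU.Reached OnU.parent-Reached onU⇒root root⇒onU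
                              e (reached r~e) (reached (connected-end r~e)) }
    where
    U : Cycle S
    U = fundamentalCycle e₀ ¬tree p≡q
    U-unbalanced : Unbalanced S U
    U-unbalanced balanced with trans (sym negative) balanced
    ... | ()
    values : ∃[ y ] All (λ s → Matches (assignAlong y (steps U)) f (proj₁ s)) (steps U)
    values = unbalancedCycle-values U U-unbalanced (condition U U-unbalanced)
    y₀ : Carrier
    y₀ = proj₁ values
    onU? : ∀ v → Dec (v ∈ tails (steps U))
    onU? v = Data.List.Membership.DecPropositional._∈?_ Fin._≟_ v (tails (steps U))
    onU : V → Bool
    onU v = does (onU? v)
    module OnU = Closure onU
    open UnbalancedComponent G S ω compatible f tension OnU.forest U U-unbalanced y₀
    onU⇒root : ∀ {v} → v ∈ tails (steps U) → OnU.depth v ≡ 0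
    onU⇒root {v} v∈ = OnU.root⇒depth≡0 v (dec-true (onU? v) v∈)
    root⇒onU : ∀ {v} → OnU.Reached v → OnU.depth v ≡ 0 → v ∈ tails (steps U)
    root⇒onU {v} reached d≡0 with onU? v | OnU.depth≡0⇒root v reached d≡0
    ... | yes v∈ | _  = v∈
    ... | no _   | ()
    reached : ∀ {v} → Connected r v → OnU.Reached v
    reached r~v = Connected-induction (start U) OnU.Reached
      (OnU.Reached-root (start U) (dec-true (onU? (start U)) (IsWalk-nonEmpty⇒∈tails (steps U) (closed U) (nonempty U))))
      OnU.Reached-step _ (Connected-trans (Connected-sym r~e₀) r~v)

  result : Result
  result with any? unbalancedFundamental?
  ... | yes (e₀ , unbalanced) = unbalancedComponent e₀ unbalanced
  ... | no  none              = balancedComponent λ e unbalanced → none (e , unbalanced)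

module _ {c ℓ} (G : AbelianGroup c ℓ) (S : SignedGraph) (ω : Orientation S) (compatible : Compatible S ω)
         (f : Fin (nE S) → AbelianGroup.Carrier G) (tension : IsTension G S ω f) where
  open AbelianGroup G using (Carrier; reflexive; refl)
  open Walks S using (V)
  open Coboundary G S ω
  open Components S

  UnbalancedCycleCondition⇒InImageδ : UnbalancedCycleCondition G S ω f → InImageδ G S ω f
  UnbalancedCycleCondition⇒InImageδ condition = potential , λ e → δ≈f (Matches-cong {g′ = potential} e
      (reflexive (cong (λ r → Result.potential (result r) (end S e true)) (representative-step (e , false)))) refl
      (Result.matches (result (representative (end S e false))) e (Connected-representative (end S e false))))
    where
    open ComponentPotential G S ω compatible f tension condition
    potential : V → Carrier
    potential v = Result.potential (result (representative v)) v

theorem7p14 : ∀ {c ℓ : Level} (G : AbelianGroup c ℓ) → FiniteGroup G →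
    (S : SignedGraph) → UnbalancedGraph S →
    (ω : Orientation S) → Compatible S ω →
    (f : Fin (nE S) → AbelianGroup.Carrier G) → IsTension G S ω f →
    (InImageδ G S ω f ⇔ UnbalancedCycleCondition G S ω f)
      × (InImageδ G S ω f ⇔ IsPotentialDifference G S ω f)
theorem7p14 G _ S _ ω compatible f tension = mk⇔ necessary sufficient , mk⇔ (λ image → tension , necessary image) (sufficient ∘ proj₂)
  where
  necessary : InImageδ G S ω f → UnbalancedCycleCondition G S ω f
  necessary image X _ = Coboundary.InImageδ⇒closedWalk-In2G G S ω image (steps X) (closed X)
  sufficient : UnbalancedCycleCondition G S ω f → InImageδ G S ω f
  sufficient = UnbalancedCycleCondition⇒InImageδ G S ω compatible f tension
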